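{- Let $d\geq 2$ be an integer, $n$ a positive integer, $x$ an indeterminate, and $s\in\{ -1,1\}$ with $n\equiv s\pmod{2d}$. Then $$\sum_{k=0}^{n-1}\frac{(x;q^d)_k\,(q^s;q^d)_k}{(q^d;q^d)_k}\,q^{dk}\equiv \sum_{k=0}^{n-1}\frac{(x^2;q^{2d})_k\,(q^s;q^{2d})_k}{(q^{2d};q^{2d})_k}\,q^{2dk} \pmod{\Phi_n(q)}.$$
   Context: The $q$-shifted factorial is $(a;q)_0=1$ and $(a;q)_k=(1-a)(1-aq)\cdots(1-aq^{k-1})$ for $k\geq 1$. $\Phi_n(q)$ denotes the $n$th cyclotomic polynomial. A congruence $A\equiv B \pmod{P(q)}$ between rational functions in $q$ (with coefficients that may involve other indeterminates such as $x$) means that $A-B$ can be written as a quotient whose numerator is divisible by $P(q)$ and whose denominator is coprime to $P(q)$. -}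

module Defs where

open import Data.Nat as ℕ using (ℕ; zero; suc)
open import Data.Nat.Divisibility using (_∣?_)
open import Data.Integer as ℤ using (ℤ; +_; -[1+_])
open import Data.List using (List; []; _∷_; map; filter; upTo; replicate; _++_; foldr)
open import Data.Product using (_×_; _,_; Σ; proj₁; proj₂)
open import Relation.Binary.PropositionalEquality using (_≡_)
open import Relation.Nullary using (¬_)

-- Dense list polynomials over a coefficient type A
-- (index i of the list = coefficient of the i-th power).

module ListPoly {A : Set} (0# : A) (_+_ _*_ : A → A → A) (-_ : A → A) where
  add : List A → List A → List A
  add [] g = g
  add (a ∷ f) [] = a ∷ f
  add (a ∷ f) (b ∷ g) = (a + b) ∷ add f g

  neg : List A → List A
  neg = map -_

  mul : List A → List A → List A
  mul [] g = []
  mul (a ∷ f) g = add (map (a *_) g) (0# ∷ mul f g)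

lookupD : {A : Set} → A → List A → ℕ → A
lookupD z [] i = z
lookupD z (a ∷ f) zero = a
lookupD z (a ∷ f) (suc i) = lookupD z f i

-- ℤ[x] : list of integer coefficients in powers of x
PolyX : Set
PolyX = List ℤ

module PX = ListPoly (+ 0) ℤ._+_ ℤ._*_ ℤ.-_

-- ℤ[x,q] = (ℤ[x])[q] : list indexed by powers of q of polynomials in x
Poly : Set
Poly = List PolyX

module PQ = ListPoly [] PX.add PX.mul PX.neg

_⊕_ : Poly → Poly → Poly
_⊕_ = PQ.add

_⊗_ : Poly → Poly → Poly
_⊗_ = PQ.mul

⊖_ : Poly → Poly
⊖_ = PQ.neg

coeff : Poly → ℕ → ℕ → ℤ
coeff p i j = lookupD (+ 0) (lookupD [] p i) j

-- equality of polynomials (insensitive to trailing zeros)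
_≈_ : Poly → Poly → Set
p ≈ r = ∀ i j → coeff p i j ≡ coeff r i j

0P : Poly
0P = []

1P : Poly
1P = (+ 1 ∷ []) ∷ []

xP : Poly
xP = (+ 0 ∷ + 1 ∷ []) ∷ []

qpow : ℕ → Poly
qpow m = replicate m [] ++ (1P)

_∣P_ : Poly → Poly → Set
c ∣P p = Σ Poly λ m → p ≈ (c ⊗ m)

Coprime : Poly → Poly → Set
Coprime a b = ∀ c → c ∣P a → c ∣P b → c ∣P 1P

prodP : List Poly → Poly
prodP = foldr _⊗_ 1P

divisors : ℕ → List ℕ
divisors n = filter (λ d → d ∣? n) (map suc (upTo n))

-- Φ is the family of cyclotomic polynomials (in q):
-- q^n - 1 = ∏_{d ∣ n} Φ_d(q) for all n ≥ 1 (this determines Φ_n uniquely).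
IsCyclotomic : (ℕ → Poly) → Set
IsCyclotomic Φ = ∀ n → 1 ℕ.≤ n → (qpow n ⊕ (⊖ 1P)) ≈ prodP (map Φ (divisors n))

-- Rational functions in x, q as formal quotients num / den

Frac : Set
Frac = Poly × Poly

num den : Frac → Poly
num = proj₁
den = proj₂

poly : Poly → Frac
poly p = p , 1P

_+F_ : Frac → Frac → Frac
(a , b) +F (c , e) = ((a ⊗ e) ⊕ (c ⊗ b)) , (b ⊗ e)

_-F_ : Frac → Frac → Frac
(a , b) -F (c , e) = ((a ⊗ e) ⊕ (⊖ (c ⊗ b))) , (b ⊗ e)

_*F_ : Frac → Frac → Frac
(a , b) *F (c , e) = (a ⊗ c) , (b ⊗ e)

_/F_ : Frac → Frac → Frac
(a , b) /F (c , e) = (a ⊗ e) , (b ⊗ c)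

0F 1F : Frac
0F = poly 0P
1F = poly 1P

_^F_ : Frac → ℕ → Frac
a ^F zero = 1F
a ^F suc k = (a ^F k) *F a

qZ : ℤ → Frac
qZ (+ m) = poly (qpow m)
qZ -[1+ m ] = 1P , qpow (suc m)

poch : Frac → Frac → ℕ → Frac
poch a b zero = 1F
poch a b (suc k) = poch a b k *F (1F -F (a *F (b ^F k)))

sumF : (ℕ → Frac) → ℕ → Frac
sumF f zero = 0F
sumF f (suc k) = sumF f k +F f k

CongMod : Poly → Frac → Frac → Set
CongMod P A B =
  Σ Poly λ N → Σ Poly λ D →
    ((num (A -F B) ⊗ D) ≈ (N ⊗ den (A -F B)))
    × (P ∣P N) × Coprime D P × ¬ (D ≈ 0P)

LHS : ℕ → ℤ → ℕ → Frac
LHS d s n = sumF (λ k →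
  ((poch (poly xP) (qZ (+ d)) k *F poch (qZ s) (qZ (+ d)) k)
     /F poch (qZ (+ d)) (qZ (+ d)) k)
  *F qZ (+ (d ℕ.* k))) n

RHS : ℕ → ℤ → ℕ → Frac
RHS d s n = sumF (λ k →
  ((poch (poly (xP ⊗ xP)) (qZ (+ (2 ℕ.* d))) k *F poch (qZ s) (qZ (+ (2 ℕ.* d))) k)
     /F poch (qZ (+ (2 ℕ.* d))) (qZ (+ (2 ℕ.* d))) k)
  *F qZ (+ (2 ℕ.* d ℕ.* k))) n

-- Write n - s = 2dm. Modulo Φ_n(q) we have q^n ≡ 1, hence q^s ≡ (q^d)^(-2m) ≡ (q^(2d))^(-m), and both
-- sides become terminating q-Chu-Vandermonde sums Σ_k (a;Q)_k (Q^(-N);Q)_k Q^k / (Q;Q)_k = a^N: the left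
-- one with (Q, a, N) = (q^d, x, 2m), the right one with (q^(2d), x², m); both equal x^(2m).
-- The sums are evaluated in the ring of fractions whose denominators are invertible modulo Φ_n up to a
-- nonzero integer. The factors q^J - 1 of (Q;Q)_k, k < n, qualify because d is prime to n, so n ∤ J:
-- for g = gcd(J, n) < n, q^g - 1 lies in the ideal (q^J - 1, q^n - 1), while Φ_n divides
-- (q^n - 1)/(q^g - 1), which is ≡ n/g modulo q^g - 1.

module Submission where
open import Algebra.Bundles using (CommutativeRing)
open import Level using (0ℓ)
open import Data.Nat.Base using (ℕ; suc; _≤_)
open import Data.Product using (Σ)
open import Defs using (Poly; IsCyclotomic)

module IntegerCoefficientSolver (R : CommutativeRing 0ℓ 0ℓ) where
  open CommutativeRing R
  open import Data.Integer as ℤ using (ℤ; +_; -[1+_]; _⊖_)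
  import Data.Integer.Properties as ℤ
  open import Data.Nat as ℕ using (zero; suc)
  import Data.Nat.Properties as ℕ
  open import Data.Maybe using (Maybe; just; nothing)
  open import Relation.Nullary using (yes; no)
  import Relation.Binary.PropositionalEquality as ≡
  open import Algebra.Properties.Ring ring using (-‿distribˡ-*; -‿distribʳ-*)
  open import Algebra.Properties.AbelianGroup +-abelianGroup using (⁻¹-∙-comm)
  open import Algebra.Properties.Group +-group using (ε⁻¹≈ε; ⁻¹-involutive)
  open import Algebra.Properties.Semiring.Mult.TCOptimised semiring using (_×_; ×-homo-+; ×1-homo-*; 1+×)
  open import Relation.Binary.Reasoning.Setoid setoid
  import Algebra.Solver.Ring.AlmostCommutativeRing as ACR

  ⟦_⟧ℤ : ℤ → Carrier
  ⟦ + n ⟧ℤ = n × 1#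
  ⟦ -[1+ n ] ⟧ℤ = - (suc n × 1#)

  ⟦⟧-homo-neg : ∀ i → ⟦ ℤ.- i ⟧ℤ ≈ - ⟦ i ⟧ℤ
  ⟦⟧-homo-neg (+ zero) = sym ε⁻¹≈ε
  ⟦⟧-homo-neg (+ suc n) = refl
  ⟦⟧-homo-neg -[1+ n ] = sym (⁻¹-involutive _)

  -‿cancel-+ˡ : ∀ c a b → (c + a) - (c + b) ≈ a - b
  -‿cancel-+ˡ c a b = begin
    (c + a) - (c + b)      ≈⟨ +-cong (+-comm c a) (sym (⁻¹-∙-comm c b)) ⟩
    (a + c) + (- c - b)    ≈⟨ +-assoc a c _ ⟩
    a + (c + (- c - b))    ≈⟨ +-congˡ (sym (+-assoc c (- c) (- b))) ⟩
    a + ((c - c) - b)      ≈⟨ +-congˡ (+-congʳ (-‿inverseʳ c)) ⟩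
    a + (0# - b)           ≈⟨ +-congˡ (+-identityˡ (- b)) ⟩
    a - b                  ∎

  ⟦⟧-homo-⊖ : ∀ m n → ⟦ m ⊖ n ⟧ℤ ≈ m × 1# - n × 1#
  ⟦⟧-homo-⊖ m zero = sym (trans (+-congˡ ε⁻¹≈ε) (+-identityʳ _))
  ⟦⟧-homo-⊖ zero (suc n) = sym (+-identityˡ _)
  ⟦⟧-homo-⊖ (suc m) (suc n) = begin
    ⟦ suc m ⊖ suc n ⟧ℤ             ≡⟨ ≡.cong ⟦_⟧ℤ (ℤ.[1+m]⊖[1+n]≡m⊖n m n) ⟩
    ⟦ m ⊖ n ⟧ℤ                     ≈⟨ ⟦⟧-homo-⊖ m n ⟩
    m × 1# - n × 1#                ≈⟨ -‿cancel-+ˡ 1# _ _ ⟨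
    (1# + m × 1#) - (1# + n × 1#)  ≈⟨ +-cong (1+× m 1#) (-‿cong (1+× n 1#)) ⟨
    suc m × 1# - suc n × 1#        ∎

  ⟦⟧-homo-+ : ∀ i j → ⟦ i ℤ.+ j ⟧ℤ ≈ ⟦ i ⟧ℤ + ⟦ j ⟧ℤ
  ⟦⟧-homo-+ -[1+ m ] -[1+ n ] = begin
    - (suc (suc (m ℕ.+ n)) × 1#)      ≡⟨ ≡.cong (λ k → - (suc k × 1#)) (ℕ.+-suc m n) ⟨
    - ((suc m ℕ.+ suc n) × 1#)        ≈⟨ -‿cong (×-homo-+ 1# (suc m) (suc n)) ⟩
    - (suc m × 1# + suc n × 1#)       ≈⟨ ⁻¹-∙-comm _ _ ⟨
    - (suc m × 1#) + - (suc n × 1#)   ∎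
  ⟦⟧-homo-+ -[1+ m ] (+ n) = trans (⟦⟧-homo-⊖ n (suc m)) (+-comm _ _)
  ⟦⟧-homo-+ (+ m) -[1+ n ] = ⟦⟧-homo-⊖ m (suc n)
  ⟦⟧-homo-+ (+ m) (+ n) = ×-homo-+ 1# m n

  ⟦⟧-homo-*₊ : ∀ m j → ⟦ + m ℤ.* j ⟧ℤ ≈ ⟦ + m ⟧ℤ * ⟦ j ⟧ℤ
  ⟦⟧-homo-*₊ m (+ n) = trans (reflexive (≡.cong ⟦_⟧ℤ (≡.sym (ℤ.pos-* m n)))) (×1-homo-* m n)
  ⟦⟧-homo-*₊ m -[1+ n ] = begin
    ⟦ + m ℤ.* ℤ.- (+ suc n) ⟧ℤ   ≡⟨ ≡.cong ⟦_⟧ℤ (ℤ.neg-distribʳ-* (+ m) (+ suc n)) ⟨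
    ⟦ ℤ.- (+ m ℤ.* + suc n) ⟧ℤ   ≈⟨ ⟦⟧-homo-neg (+ m ℤ.* + suc n) ⟩
    - ⟦ + m ℤ.* + suc n ⟧ℤ       ≈⟨ -‿cong (⟦⟧-homo-*₊ m (+ suc n)) ⟩
    - (⟦ + m ⟧ℤ * ⟦ + suc n ⟧ℤ)  ≈⟨ -‿distribʳ-* _ _ ⟩
    ⟦ + m ⟧ℤ * - ⟦ + suc n ⟧ℤ    ∎

  ⟦⟧-homo-* : ∀ i j → ⟦ i ℤ.* j ⟧ℤ ≈ ⟦ i ⟧ℤ * ⟦ j ⟧ℤ
  ⟦⟧-homo-* (+ m) j = ⟦⟧-homo-*₊ m j
  ⟦⟧-homo-* -[1+ m ] j = begin
    ⟦ ℤ.- (+ suc m) ℤ.* j ⟧ℤ    ≡⟨ ≡.cong ⟦_⟧ℤ (ℤ.neg-distribˡ-* (+ suc m) j) ⟨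
    ⟦ ℤ.- (+ suc m ℤ.* j) ⟧ℤ    ≈⟨ ⟦⟧-homo-neg (+ suc m ℤ.* j) ⟩
    - ⟦ + suc m ℤ.* j ⟧ℤ        ≈⟨ -‿cong (⟦⟧-homo-*₊ (suc m) j) ⟩
    - (⟦ + suc m ⟧ℤ * ⟦ j ⟧ℤ)   ≈⟨ -‿distribˡ-* _ _ ⟩
    - ⟦ + suc m ⟧ℤ * ⟦ j ⟧ℤ     ∎

  ℤ⟶R : ℤ.+-*-rawRing ACR.-Raw-AlmostCommutative⟶ ACR.fromCommutativeRing R
  ℤ⟶R = record
    { ⟦_⟧ = ⟦_⟧ℤ ; +-homo = ⟦⟧-homo-+ ; *-homo = ⟦⟧-homo-* ; -‿homo = ⟦⟧-homo-neg
    ; 0-homo = refl ; 1-homo = refl }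

  ≟-weak : ∀ i j → Maybe (⟦ i ⟧ℤ ≈ ⟦ j ⟧ℤ)
  ≟-weak i j with i ℤ.≟ j
  ... | yes ≡.refl = just refl
  ... | no _ = nothing

  open import Algebra.Solver.Ring ℤ.+-*-rawRing (ACR.fromCommutativeRing R) ℤ⟶R ≟-weak public


module ListPolynomial (R : CommutativeRing 0ℓ 0ℓ) where
  open CommutativeRing R renaming (Carrier to A) hiding (zero)
  open import Algebra.Properties.Group +-group using (ε⁻¹≈ε)
  import Data.Integer as ℤ
  open import Data.Nat using (ℕ; zero; suc)
  open import Data.List using (List; []; _∷_; map)
  open import Data.Product using (_,_)
  open import Function using (_∘_)
  open import Relation.Binary.Bundles using (Setoid)
  import Relation.Binary.Reasoning.Setoid as SetoidReasoning
  open import Defs using (module ListPoly; lookupD)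
  open IntegerCoefficientSolver R using (solve; _:=_; _:+_; _:*_; :-_; con)
  open ListPoly 0# _+_ _*_ -_ public

  infix 4 _≋_
  infixl 9 _!_

  _!_ : List A → ℕ → A
  f ! i = lookupD 0# f i

  record _≋_ (f g : List A) : Set where
    constructor mk≋
    field get≋ : ∀ i → f ! i ≈ g ! i
  open _≋_ public

  ≋-refl : ∀ {f} → f ≋ f
  ≋-refl = mk≋ λ i → refl

  ≋-sym : ∀ {f g} → f ≋ g → g ≋ f
  ≋-sym h = mk≋ λ i → sym (get≋ h i)

  ≋-trans : ∀ {f g h} → f ≋ g → g ≋ h → f ≋ h
  ≋-trans p q = mk≋ λ i → trans (get≋ p i) (get≋ q i)

  ≋-setoid : Setoid 0ℓ 0ℓ
  ≋-setoid = record
    { Carrier = List A ; _≈_ = _≋_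
    ; isEquivalence = record { refl = ≋-refl ; sym = ≋-sym ; trans = ≋-trans } }

  module ≈-Reasoning = SetoidReasoning setoid
  module ≋-Reasoning = SetoidReasoning ≋-setoid

  scale : A → List A → List A
  scale a = map (a *_)

  one : List A
  one = 1# ∷ []

  !-add : ∀ f g i → add f g ! i ≈ f ! i + g ! i
  !-add [] g i = sym (+-identityˡ _)
  !-add (a ∷ f) [] i = sym (+-identityʳ _)
  !-add (a ∷ f) (b ∷ g) zero = refl
  !-add (a ∷ f) (b ∷ g) (suc i) = !-add f g i

  !-neg : ∀ f i → neg f ! i ≈ - (f ! i)
  !-neg [] i = sym ε⁻¹≈ε
  !-neg (a ∷ f) zero = refl
  !-neg (a ∷ f) (suc i) = !-neg f i

  !-scale : ∀ a g i → scale a g ! i ≈ a * (g ! i)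
  !-scale a [] i = sym (zeroʳ a)
  !-scale a (b ∷ g) zero = refl
  !-scale a (b ∷ g) (suc i) = !-scale a g i

  !-0∷[] : ∀ i → (0# ∷ []) ! i ≈ 0#
  !-0∷[] zero = refl
  !-0∷[] (suc i) = refl

  !-mul-const : ∀ a f i → mul (a ∷ []) f ! i ≈ a * f ! i
  !-mul-const a f i = trans (!-add (scale a f) (0# ∷ []) i)
    (trans (+-cong (!-scale a f i) (!-0∷[] i)) (+-identityʳ _))

  ∷-cong : ∀ {a b f g} → a ≈ b → f ≋ g → (a ∷ f) ≋ (b ∷ g)
  ∷-cong p q = mk≋ λ where
    zero → p
    (suc i) → get≋ q i

  tail-≋ : ∀ {a b f g} → (a ∷ f) ≋ (b ∷ g) → f ≋ g
  tail-≋ h = mk≋ (get≋ h ∘ suc)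

  add-cong : ∀ {f f′ g g′} → f ≋ f′ → g ≋ g′ → add f g ≋ add f′ g′
  add-cong {f} {f′} {g} {g′} p q = mk≋ λ i →
    trans (!-add f g i) (trans (+-cong (get≋ p i) (get≋ q i)) (sym (!-add f′ g′ i)))

  neg-cong : ∀ {f f′} → f ≋ f′ → neg f ≋ neg f′
  neg-cong {f} {f′} p = mk≋ λ i → trans (!-neg f i) (trans (-‿cong (get≋ p i)) (sym (!-neg f′ i)))

  scale-cong : ∀ {a b f g} → a ≈ b → f ≋ g → scale a f ≋ scale b g
  scale-cong {a} {b} {f} {g} p q = mk≋ λ i →
    trans (!-scale a f i) (trans (*-cong p (get≋ q i)) (sym (!-scale b g i)))

  mul-zeroˡ : ∀ f g → f ≋ [] → mul f g ≋ []
  mul-zeroˡ [] g h = ≋-refl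
  mul-zeroˡ (a ∷ f) g h = mk≋ λ i → begin
      add (scale a g) (0# ∷ mul f g) ! i  ≈⟨ !-add (scale a g) _ i ⟩
      scale a g ! i + (0# ∷ mul f g) ! i  ≈⟨ +-cong (trans (!-scale a g i) (trans (*-congʳ (get≋ h zero)) (zeroˡ _)))
                                                    (trans (get≋ (∷-cong refl (mul-zeroˡ f g (mk≋ (get≋ h ∘ suc)))) i) (!-0∷[] i)) ⟩
      0# + 0#                             ≈⟨ +-identityˡ 0# ⟩
      0#                                  ∎
    where open ≈-Reasoning

  mul-congˡ : ∀ f f′ g → f ≋ f′ → mul f g ≋ mul f′ g
  mul-congˡ [] [] g h = ≋-refl
  mul-congˡ [] (b ∷ f′) g h = ≋-sym (mul-zeroˡ (b ∷ f′) g (≋-sym h))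
  mul-congˡ (a ∷ f) [] g h = mul-zeroˡ (a ∷ f) g h
  mul-congˡ (a ∷ f) (b ∷ f′) g h =
    add-cong {scale a g} {scale b g} {0# ∷ mul f g} {0# ∷ mul f′ g}
      (scale-cong (get≋ h zero) ≋-refl) (∷-cong refl (mul-congˡ f f′ g (tail-≋ h)))

  mul-congʳ : ∀ f {g g′} → g ≋ g′ → mul f g ≋ mul f g′
  mul-congʳ [] h = ≋-refl
  mul-congʳ (a ∷ f) {g} {g′} h =
    add-cong {scale a g} {scale a g′} {0# ∷ mul f g} {0# ∷ mul f g′}
      (scale-cong refl h) (∷-cong refl (mul-congʳ f h))

  mul-cong : ∀ {f f′ g g′} → f ≋ f′ → g ≋ g′ → mul f g ≋ mul f′ g′
  mul-cong {f} {f′} {g} p q = ≋-trans (mul-congˡ f f′ g p) (mul-congʳ f′ q)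

  add-assoc : ∀ f g h → add (add f g) h ≋ add f (add g h)
  add-assoc f g h = mk≋ λ i → begin
      add (add f g) h ! i    ≈⟨ trans (!-add (add f g) h i) (+-congʳ (!-add f g i)) ⟩
      f ! i + g ! i + h ! i  ≈⟨ +-assoc _ _ _ ⟩
      f ! i + (g ! i + h ! i) ≈⟨ trans (!-add f (add g h) i) (+-congˡ (!-add g h i)) ⟨
      add f (add g h) ! i    ∎
    where open ≈-Reasoning

  add-comm : ∀ f g → add f g ≋ add g f
  add-comm f g = mk≋ λ i → trans (!-add f g i) (trans (+-comm _ _) (sym (!-add g f i)))

  add-identityʳ : ∀ f → add f [] ≋ f
  add-identityʳ f = mk≋ λ i → trans (!-add f [] i) (+-identityʳ _)

  neg-inverseˡ : ∀ f → add (neg f) f ≋ []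
  neg-inverseˡ f = mk≋ λ i → trans (!-add (neg f) f i) (trans (+-congʳ (!-neg f i)) (-‿inverseˡ _))

  neg-inverseʳ : ∀ f → add f (neg f) ≋ []
  neg-inverseʳ f = mk≋ λ i → trans (!-add f (neg f) i) (trans (+-congˡ (!-neg f i)) (-‿inverseʳ _))

  add-interchange : ∀ f g h k → add (add f g) (add h k) ≋ add (add f h) (add g k)
  add-interchange f g h k = mk≋ λ i → begin
      add (add f g) (add h k) ! i    ≈⟨ trans (!-add (add f g) (add h k) i) (+-cong (!-add f g i) (!-add h k i)) ⟩
      (f ! i + g ! i) + (h ! i + k ! i) ≈⟨ solve 4 (λ a b c d → (a :+ b) :+ (c :+ d) := (a :+ c) :+ (b :+ d)) refl _ _ _ _ ⟩
      (f ! i + h ! i) + (g ! i + k ! i) ≈⟨ trans (!-add (add f h) (add g k) i) (+-cong (!-add f h i) (!-add g k i)) ⟨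
      add (add f h) (add g k) ! i    ∎
    where open ≈-Reasoning

  add-swap : ∀ f g h → add f (add g h) ≋ add g (add f h)
  add-swap f g h = mk≋ λ i → begin
      add f (add g h) ! i      ≈⟨ trans (!-add f (add g h) i) (+-congˡ (!-add g h i)) ⟩
      f ! i + (g ! i + h ! i)  ≈⟨ solve 3 (λ x y z → x :+ (y :+ z) := y :+ (x :+ z)) refl _ _ _ ⟩
      g ! i + (f ! i + h ! i)  ≈⟨ trans (!-add g (add f h) i) (+-congˡ (!-add f h i)) ⟨
      add g (add f h) ! i      ∎
    where open ≈-Reasoning

  0∷-add : ∀ f g → (0# ∷ add f g) ≋ add (0# ∷ f) (0# ∷ g)
  0∷-add f g = ∷-cong (sym (+-identityˡ 0#)) ≋-refl

  scale-distribˡ : ∀ a f g → scale a (add f g) ≋ add (scale a f) (scale a g)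
  scale-distribˡ a f g = mk≋ λ i → begin
      scale a (add f g) ! i          ≈⟨ trans (!-scale a (add f g) i) (*-congˡ (!-add f g i)) ⟩
      a * (f ! i + g ! i)            ≈⟨ distribˡ a _ _ ⟩
      a * f ! i + a * g ! i          ≈⟨ trans (!-add (scale a f) (scale a g) i) (+-cong (!-scale a f i) (!-scale a g i)) ⟨
      add (scale a f) (scale a g) ! i ∎
    where open ≈-Reasoning

  scale-distribʳ : ∀ a b f → scale (a + b) f ≋ add (scale a f) (scale b f)
  scale-distribʳ a b f = mk≋ λ i → begin
      scale (a + b) f ! i            ≈⟨ !-scale (a + b) f i ⟩
      (a + b) * f ! i                ≈⟨ distribʳ _ a b ⟩
      a * f ! i + b * f ! i          ≈⟨ trans (!-add (scale a f) (scale b f) i) (+-cong (!-scale a f i) (!-scale b f i)) ⟨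
      add (scale a f) (scale b f) ! i ∎
    where open ≈-Reasoning

  scale-scale : ∀ a b f → scale a (scale b f) ≋ scale (a * b) f
  scale-scale a b f = mk≋ λ i → begin
      scale a (scale b f) ! i  ≈⟨ trans (!-scale a (scale b f) i) (*-congˡ (!-scale b f i)) ⟩
      a * (b * f ! i)          ≈⟨ *-assoc a b _ ⟨
      a * b * f ! i            ≈⟨ !-scale (a * b) f i ⟨
      scale (a * b) f ! i      ∎
    where open ≈-Reasoning

  mul-0∷ : ∀ f g → mul (0# ∷ f) g ≋ (0# ∷ mul f g)
  mul-0∷ f g = mk≋ λ i → trans (!-add (scale 0# g) _ i)
    (trans (+-congʳ (trans (!-scale 0# g i) (zeroˡ _))) (+-identityˡ _))

  mul-scale : ∀ a f g → mul (scale a f) g ≋ scale a (mul f g)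
  mul-scale a [] g = ≋-refl
  mul-scale a (b ∷ f) g = begin
      add (scale (a * b) g) (0# ∷ mul (scale a f) g)   ≈⟨ add-cong {scale (a * b) g} {scale a (scale b g)}
                                                             (≋-sym (scale-scale a b g)) (∷-cong (sym (zeroʳ a)) (mul-scale a f g)) ⟩
      add (scale a (scale b g)) (scale a (0# ∷ mul f g)) ≈⟨ scale-distribˡ a (scale b g) (0# ∷ mul f g) ⟨
      scale a (add (scale b g) (0# ∷ mul f g))         ∎
    where open ≋-Reasoning

  mul-distribˡ : ∀ f g h → mul f (add g h) ≋ add (mul f g) (mul f h)
  mul-distribˡ [] g h = ≋-refl
  mul-distribˡ (a ∷ f) g h = begin
      add (scale a (add g h)) (0# ∷ mul f (add g h))
        ≈⟨ add-cong {scale a (add g h)} (scale-distribˡ a g h)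
             (≋-trans (∷-cong refl (mul-distribˡ f g h)) (0∷-add (mul f g) (mul f h))) ⟩
      add (add (scale a g) (scale a h)) (add (0# ∷ mul f g) (0# ∷ mul f h))
        ≈⟨ add-interchange (scale a g) (scale a h) (0# ∷ mul f g) (0# ∷ mul f h) ⟩
      add (add (scale a g) (0# ∷ mul f g)) (add (scale a h) (0# ∷ mul f h)) ∎
    where open ≋-Reasoning

  mul-distribʳ : ∀ f g h → mul (add f g) h ≋ add (mul f h) (mul g h)
  mul-distribʳ [] g h = ≋-refl
  mul-distribʳ (a ∷ f) [] h = ≋-sym (add-identityʳ (mul (a ∷ f) h))
  mul-distribʳ (a ∷ f) (b ∷ g) h = begin
      add (scale (a + b) h) (0# ∷ mul (add f g) h)
        ≈⟨ add-cong {scale (a + b) h} (scale-distribʳ a b h)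
             (≋-trans (∷-cong refl (mul-distribʳ f g h)) (0∷-add (mul f h) (mul g h))) ⟩
      add (add (scale a h) (scale b h)) (add (0# ∷ mul f h) (0# ∷ mul g h))
        ≈⟨ add-interchange (scale a h) (scale b h) (0# ∷ mul f h) (0# ∷ mul g h) ⟩
      add (add (scale a h) (0# ∷ mul f h)) (add (scale b h) (0# ∷ mul g h)) ∎
    where open ≋-Reasoning

  mul-zeroʳ : ∀ f → mul f [] ≋ []
  mul-zeroʳ [] = ≋-refl
  mul-zeroʳ (a ∷ f) = ≋-trans (∷-cong refl (mul-zeroʳ f)) (mk≋ !-0∷[])

  mul-∷ʳ : ∀ f a g → mul f (a ∷ g) ≋ add (scale a f) (0# ∷ mul f g)
  mul-∷ʳ [] a g = ≋-sym (mk≋ !-0∷[])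
  mul-∷ʳ (b ∷ f) a g = begin
      add (scale b (a ∷ g)) (0# ∷ mul f (a ∷ g))
        ≈⟨ add-cong {scale b (a ∷ g)} ≋-refl (∷-cong refl (mul-∷ʳ f a g)) ⟩
      add (b * a ∷ scale b g) (0# ∷ add (scale a f) (0# ∷ mul f g))
        ≈⟨ ∷-cong (+-congʳ (*-comm b a)) (add-swap (scale b g) (scale a f) (0# ∷ mul f g)) ⟩
      add (a * b ∷ scale a f) (0# ∷ add (scale b g) (0# ∷ mul f g)) ∎
    where open ≋-Reasoning

  mul-comm : ∀ f g → mul f g ≋ mul g f
  mul-comm [] g = ≋-sym (mul-zeroʳ g)
  mul-comm (a ∷ f) g =
    ≋-trans (add-cong {scale a g} ≋-refl (∷-cong refl (mul-comm f g))) (≋-sym (mul-∷ʳ g a f))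

  mul-assoc : ∀ f g h → mul (mul f g) h ≋ mul f (mul g h)
  mul-assoc [] g h = ≋-refl
  mul-assoc (a ∷ f) g h = begin
      mul (add (scale a g) (0# ∷ mul f g)) h          ≈⟨ mul-distribʳ (scale a g) (0# ∷ mul f g) h ⟩
      add (mul (scale a g) h) (mul (0# ∷ mul f g) h)  ≈⟨ add-cong {mul (scale a g) h} (mul-scale a g h) (mul-0∷ (mul f g) h) ⟩
      add (scale a (mul g h)) (0# ∷ mul (mul f g) h)  ≈⟨ add-cong {scale a (mul g h)} ≋-refl (∷-cong refl (mul-assoc f g h)) ⟩
      add (scale a (mul g h)) (0# ∷ mul f (mul g h))  ∎
    where open ≋-Reasoning

  mul-identityˡ : ∀ f → mul one f ≋ f
  mul-identityˡ f = mk≋ λ i → trans (!-add (scale 1# f) (0# ∷ []) i)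
    (trans (+-cong (trans (!-scale 1# f i) (*-identityˡ _)) (!-0∷[] i)) (+-identityʳ _))

  polyRing : CommutativeRing 0ℓ 0ℓ
  polyRing = record
    { Carrier = List A ; _≈_ = _≋_ ; _+_ = add ; _*_ = mul ; -_ = neg ; 0# = [] ; 1# = one
    ; isCommutativeRing = record
      { isRing = record
        { +-isAbelianGroup = record
          { isGroup = record
            { isMonoid = record
              { isSemigroup = record
                { isMagma = record { isEquivalence = Setoid.isEquivalence ≋-setoid ; ∙-cong = add-cong }
                ; assoc = add-assoc }
              ; identity = (λ f → ≋-refl) , add-identityʳ }
            ; inverse = neg-inverseˡ , neg-inverseʳ
            ; ⁻¹-cong = neg-cong }
          ; comm = add-comm }
        ; *-cong = mul-cong
        ; *-assoc = mul-assoc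
        ; *-identity = mul-identityˡ , (λ f → ≋-trans (mul-comm f one) (mul-identityˡ f))
        ; distrib = mul-distribˡ , (λ h f g → mul-distribʳ f g h) }
      ; *-comm = mul-comm }
    }

  eval : A → List A → A
  eval t [] = 0#
  eval t (a ∷ f) = a + t * eval t f

  module Evaluation (t : A) where
    open ≈-Reasoning

    eval-add : ∀ f g → eval t (add f g) ≈ eval t f + eval t g
    eval-add [] g = sym (+-identityˡ _)
    eval-add (a ∷ f) [] = sym (+-identityʳ _)
    eval-add (a ∷ f) (b ∷ g) = begin
      (a + b) + t * eval t (add f g)          ≈⟨ +-congˡ (*-congˡ (eval-add f g)) ⟩
      (a + b) + t * (eval t f + eval t g)     ≈⟨ solve 5 (λ a b t x y → (a :+ b) :+ t :* (x :+ y) := (a :+ t :* x) :+ (b :+ t :* y)) refl a b t _ _ ⟩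
      (a + t * eval t f) + (b + t * eval t g) ∎

    eval-scale : ∀ a f → eval t (scale a f) ≈ a * eval t f
    eval-scale a [] = sym (zeroʳ a)
    eval-scale a (b ∷ f) = begin
      a * b + t * eval t (scale a f)  ≈⟨ +-congˡ (*-congˡ (eval-scale a f)) ⟩
      a * b + t * (a * eval t f)      ≈⟨ solve 4 (λ a b t x → a :* b :+ t :* (a :* x) := a :* (b :+ t :* x)) refl a b t _ ⟩
      a * (b + t * eval t f)          ∎

    eval-mul : ∀ f g → eval t (mul f g) ≈ eval t f * eval t g
    eval-mul [] g = sym (zeroˡ _)
    eval-mul (a ∷ f) g = begin
      eval t (add (scale a g) (0# ∷ mul f g))       ≈⟨ eval-add (scale a g) (0# ∷ mul f g) ⟩
      eval t (scale a g) + (0# + t * eval t (mul f g)) ≈⟨ +-cong (eval-scale a g) (+-congˡ (*-congˡ (eval-mul f g))) ⟩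
      a * eval t g + (0# + t * (eval t f * eval t g))  ≈⟨ solve 4 (λ a t x y → a :* y :+ (con (ℤ.+ 0) :+ t :* (x :* y)) := (a :+ t :* x) :* y) refl a t _ _ ⟩
      (a + t * eval t f) * eval t g                  ∎

    eval-neg : ∀ f → eval t (neg f) ≈ - eval t f
    eval-neg [] = sym ε⁻¹≈ε
    eval-neg (a ∷ f) = begin
      - a + t * eval t (neg f)  ≈⟨ +-congˡ (*-congˡ (eval-neg f)) ⟩
      - a + t * (- eval t f)    ≈⟨ solve 3 (λ a t x → :- a :+ t :* (:- x) := :- (a :+ t :* x)) refl a t _ ⟩
      - (a + t * eval t f)      ∎

    eval-zero : ∀ f → f ≋ [] → eval t f ≈ 0#
    eval-zero [] h = refl
    eval-zero (a ∷ f) h = begin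
      a + t * eval t f  ≈⟨ +-cong (get≋ h zero) (*-congˡ (eval-zero f (mk≋ (get≋ h ∘ suc)))) ⟩
      0# + t * 0#       ≈⟨ trans (+-identityˡ _) (zeroʳ t) ⟩
      0#                ∎

    eval-cong : ∀ {f g} → f ≋ g → eval t f ≈ eval t g
    eval-cong {[]} {g} h = sym (eval-zero g (≋-sym h))
    eval-cong {a ∷ f} {[]} h = eval-zero (a ∷ f) h
    eval-cong {a ∷ f} {b ∷ g} h = +-cong (get≋ h zero) (*-congˡ (eval-cong (tail-≋ h)))

module Bivariate where
  open import Data.Nat as ℕ using (ℕ; zero; suc; _<_; s≤s)
  open import Data.Integer as ℤ using (ℤ; +_)
  import Data.Integer.Properties as ℤ
  open import Data.List using ([]; _∷_)
  open import Relation.Binary.PropositionalEquality as ≡ using (_≡_)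
  open import Defs

  module ℤ[x] = ListPolynomial ℤ.+-*-commutativeRing
  module ℤ[x][q] = ListPolynomial ℤ[x].polyRing

  ℤ[x,q] : CommutativeRing 0ℓ 0ℓ
  ℤ[x,q] = ℤ[x][q].polyRing

  open CommutativeRing ℤ[x,q] public using () renaming
    ( _≈_ to _≃_; refl to ≃-refl; sym to ≃-sym; trans to ≃-trans; reflexive to ≃-reflexive
    ; setoid to ≃-setoid; +-cong to ⊕-cong; *-cong to ⊗-cong; -‿cong to ⊖-cong
    ; *-comm to ⊗-comm; *-assoc to ⊗-assoc; +-identityˡ to ⊕-identityˡ; +-identityʳ to ⊕-identityʳ
    ; *-identityˡ to ⊗-identityˡ; *-identityʳ to ⊗-identityʳ; zeroˡ to ⊗-zeroˡ; zeroʳ to ⊗-zeroʳ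
    ; distribˡ to ⊗-distribˡ; -‿inverseʳ to ⊖-inverseʳ; +-comm to ⊕-comm )
  open IntegerCoefficientSolver ℤ[x,q] public using (solve; _:=_; _:+_; _:*_; :-_; con; Polynomial)

  ⊗-congˡ : ∀ a {b c} → b ≃ c → (a ⊗ b) ≃ (a ⊗ c)
  ⊗-congˡ a = CommutativeRing.*-congˡ ℤ[x,q] {a}

  ⊗-congʳ : ∀ a {b c} → b ≃ c → (b ⊗ a) ≃ (c ⊗ a)
  ⊗-congʳ a = CommutativeRing.*-congʳ ℤ[x,q] {a}

  ⊕-congˡ : ∀ a {b c} → b ≃ c → (a ⊕ b) ≃ (a ⊕ c)
  ⊕-congˡ a = CommutativeRing.+-congˡ ℤ[x,q] {a}

  ⊕-congʳ : ∀ a {b c} → b ≃ c → (b ⊕ a) ≃ (c ⊕ a)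
  ⊕-congʳ a = CommutativeRing.+-congʳ ℤ[x,q] {a}

  ≈⇒≃ : ∀ {p r} → p ≈ r → p ≃ r
  ≈⇒≃ h = ℤ[x][q].mk≋ λ i → ℤ[x].mk≋ (h i)

  ≃⇒≈ : ∀ {p r} → p ≃ r → p ≈ r
  ≃⇒≈ h i = ℤ[x].get≋ (ℤ[x][q].get≋ h i)

  coeff-⊕ : ∀ p r i j → coeff (p ⊕ r) i j ≡ coeff p i j ℤ.+ coeff r i j
  coeff-⊕ p r i j = ≡.trans (ℤ[x].get≋ (ℤ[x][q].!-add p r i) j) (ℤ[x].!-add (p ℤ[x][q].! i) (r ℤ[x][q].! i) j)

  coeff-⊖ : ∀ p i j → coeff (⊖ p) i j ≡ ℤ.- coeff p i j
  coeff-⊖ p i j = ≡.trans (ℤ[x].get≋ (ℤ[x][q].!-neg p i) j) (ℤ[x].!-neg (p ℤ[x][q].! i) j)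

  shift : ℕ → Poly → Poly
  shift zero p = p
  shift (suc g) p = [] ∷ shift g p

  qpow-⊗ : ∀ g p → (qpow g ⊗ p) ≃ shift g p
  qpow-⊗ zero p = ℤ[x][q].mul-identityˡ p
  qpow-⊗ (suc g) p = ≃-trans (ℤ[x][q].mul-0∷ (qpow g) p) (ℤ[x][q].∷-cong ℤ[x].≋-refl (qpow-⊗ g p))

  coeff-shift-< : ∀ g p i j → i < g → coeff (shift g p) i j ≡ + 0
  coeff-shift-< (suc g) p zero j _ = ≡.refl
  coeff-shift-< (suc g) p (suc i) j (s≤s i<g) = coeff-shift-< g p i j i<g

  coeff-shift-+ : ∀ g p i j → coeff (shift g p) (g ℕ.+ i) j ≡ coeff p i j
  coeff-shift-+ zero p i j = ≡.refl
  coeff-shift-+ (suc g) p i j = coeff-shift-+ g p i j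

  qpow-+ : ∀ a b → qpow (a ℕ.+ b) ≃ (qpow a ⊗ qpow b)
  qpow-+ a b = ≃-sym (≃-trans (qpow-⊗ a (qpow b)) (≃-reflexive (shift-qpow a)))
    where
    shift-qpow : ∀ a → shift a (qpow b) ≡ qpow (a ℕ.+ b)
    shift-qpow zero = ≡.refl
    shift-qpow (suc a) = ≡.cong ([] ∷_) (shift-qpow a)

  const : ℤ → Poly
  const c = (c ∷ []) ∷ []

  coeff-const-⊗ : ∀ c p i j → coeff (const c ⊗ p) i j ≡ c ℤ.* coeff p i j
  coeff-const-⊗ c p i j =
    ≡.trans (ℤ[x].get≋ (ℤ[x][q].!-mul-const (c ∷ []) p i) j) (ℤ[x].!-mul-const c (p ℤ[x][q].! i) j)

module QPowerMinusOne where
  open import Data.Nat as ℕ using (ℕ; zero; suc; _<_; _≤_; _∸_)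
  import Data.Nat.Properties as ℕ
  open import Data.Nat.Induction using (<-rec)
  import Data.Nat.DivMod as ℕ
  open import Data.Integer as ℤ using (ℤ; +_; -[1+_])
  import Data.Integer.Properties as ℤ
  open import Data.Integer.Divisibility.Signed using (_∣_; divides; ∣-refl; ∣m∣n⇒∣m-n; ∣m⇒∣m*n; 0∣⇒≡0)
  open import Data.Integer.Tactic.RingSolver using (solve-∀)
  open import Data.List using ([]; _∷_; map)
  open import Data.Product using (Σ; _,_; proj₁; proj₂)
  import Relation.Binary.Reasoning.Setoid as SetoidReasoning
  open import Relation.Binary.PropositionalEquality as ≡ using (_≡_)
  open import Relation.Nullary using (yes; no)
  open import Defs
  open Bivariate

  qpowMinusOne : ℕ → Poly
  qpowMinusOne g = qpow g ⊕ (⊖ 1P)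

  coeff-qpowMinusOne-⊗ : ∀ g p i j → coeff (qpowMinusOne g ⊗ p) i j ≡ coeff (shift g p) i j ℤ.- coeff p i j
  coeff-qpowMinusOne-⊗ g p i j = begin
      coeff (qpowMinusOne g ⊗ p) i j               ≡⟨ ≃⇒≈ expand i j ⟩
      coeff ((qpow g ⊗ p) ⊕ (⊖ p)) i j             ≡⟨ coeff-⊕ (qpow g ⊗ p) (⊖ p) i j ⟩
      coeff (qpow g ⊗ p) i j ℤ.+ coeff (⊖ p) i j   ≡⟨ ≡.cong₂ ℤ._+_ (≃⇒≈ (qpow-⊗ g p) i j) (coeff-⊖ p i j) ⟩
      coeff (shift g p) i j ℤ.- coeff p i j        ∎
    where
    open ≡.≡-Reasoning
    expand : (qpowMinusOne g ⊗ p) ≃ ((qpow g ⊗ p) ⊕ (⊖ p))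
    expand = solve 2 (λ a c → (a :+ :- con (+ 1)) :* c := a :* c :+ :- c) ≃-refl (qpow g) p

  periodic-induction : ∀ {P : ℕ → Set} g → 1 ≤ g →
    (∀ i → i < g → P i) → (∀ i → P i → P (g ℕ.+ i)) → ∀ i → P i
  periodic-induction {P} g g≥1 base step = <-rec P go
    where
    go : ∀ i → (∀ {k} → k < i → P k) → P i
    go i rec with i ℕ.<? g
    ... | yes i<g = base i i<g
    ... | no i≮g = ≡.subst P (ℕ.m+[n∸m]≡n g≤i) (step (i ∸ g) (rec (ℕ.∸-monoʳ-< g≥1 g≤i)))
      where
      g≤i : g ≤ i
      g≤i = ℕ.≮⇒≥ i≮g

  -- p_i = (shift g p)_i - c r_i, and (shift g p)_i is 0 for i < g and p_(i-g) otherwise.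
  ∣-coeff : ∀ g → 1 ≤ g → ∀ c p r → (qpowMinusOne g ⊗ p) ≃ (const c ⊗ r) → ∀ i j → c ∣ coeff p i j
  ∣-coeff g g≥1 c p r h = periodic-induction g g≥1 base step
    where
    unshift : ∀ i j → coeff p i j ≡ coeff (shift g p) i j ℤ.- c ℤ.* coeff r i j
    unshift i j = ≡.trans (y≡x-[x-y] (coeff (shift g p) i j) (coeff p i j)) (≡.cong (λ z → coeff (shift g p) i j ℤ.- z)
      (≡.trans (≡.sym (coeff-qpowMinusOne-⊗ g p i j)) (≡.trans (≃⇒≈ h i j) (coeff-const-⊗ c r i j))))
      where
      y≡x-[x-y] : ∀ x y → y ≡ x ℤ.- (x ℤ.- y)
      y≡x-[x-y] = solve-∀
    c∣c*r : ∀ i j → c ∣ c ℤ.* coeff r i j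
    c∣c*r i j = ∣m⇒∣m*n (coeff r i j) ∣-refl
    base : ∀ i → i < g → ∀ j → c ∣ coeff p i j
    base i i<g j = ≡.subst (c ∣_) (≡.sym (unshift i j))
      (≡.subst (λ z → c ∣ z ℤ.- c ℤ.* coeff r i j) (≡.sym (coeff-shift-< g p i j i<g))
        (∣m∣n⇒∣m-n (divides (+ 0) ≡.refl) (c∣c*r i j)))
    step : ∀ i → (∀ j → c ∣ coeff p i j) → ∀ j → c ∣ coeff p (g ℕ.+ i) j
    step i ih j = ≡.subst (c ∣_) (≡.sym (unshift (g ℕ.+ i) j))
      (≡.subst (λ z → c ∣ z ℤ.- c ℤ.* coeff r (g ℕ.+ i) j) (≡.sym (coeff-shift-+ g p i j))
        (∣m∣n⇒∣m-n (ih j) (c∣c*r (g ℕ.+ i) j)))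

  qpowMinusOne-⊗-cancel : ∀ g → 1 ≤ g → ∀ p → (qpowMinusOne g ⊗ p) ≃ 0P → p ≃ 0P
  qpowMinusOne-⊗-cancel g g≥1 p h = ≈⇒≃ λ i j → 0∣⇒≡0 (∣-coeff g g≥1 (+ 0) p 0P h′ i j)
    where
    h′ : (qpowMinusOne g ⊗ p) ≃ (const (+ 0) ⊗ 0P)
    h′ = ≃-trans h (≃-sym (⊗-zeroʳ (const (+ 0))))

  -- t / (m + 1), exact when m + 1 divides t.
  divExact : ℕ → ℤ → ℤ
  divExact m (+ t) = + (t ℕ./ suc m)
  divExact m -[1+ t ] = ℤ.- (+ (suc t ℕ./ suc m))

  divExact-correct : ∀ m t → + suc m ∣ t → + suc m ℤ.* divExact m t ≡ t
  divExact-correct m t (divides (+ k) ≡.refl) = begin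
      + suc m ℤ.* divExact m (+ k ℤ.* + suc m)  ≡⟨ ≡.cong (λ z → + suc m ℤ.* divExact m z) (ℤ.pos-* k (suc m)) ⟨
      + suc m ℤ.* + (k ℕ.* suc m ℕ./ suc m)     ≡⟨ ≡.cong (λ z → + suc m ℤ.* + z) (ℕ.m*n/n≡m k (suc m)) ⟩
      + suc m ℤ.* + k                           ≡⟨ ℤ.*-comm (+ suc m) (+ k) ⟩
      + k ℤ.* + suc m                           ∎
    where open ≡.≡-Reasoning
  divExact-correct m t (divides -[1+ k ] ≡.refl) = begin
      + suc m ℤ.* ℤ.- (+ (suc (m ℕ.+ k ℕ.* suc m) ℕ./ suc m)) ≡⟨ ≡.cong (λ z → + suc m ℤ.* ℤ.- (+ z)) (ℕ.m*n/n≡m (suc k) (suc m)) ⟩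
      + suc m ℤ.* ℤ.- (+ suc k)                               ≡⟨ ℤ.neg-distribʳ-* (+ suc m) (+ suc k) ⟨
      ℤ.- (+ suc m ℤ.* + suc k)                               ≡⟨ ≡.cong ℤ.-_ (ℤ.*-comm (+ suc m) (+ suc k)) ⟩
      ℤ.- (+ suc k ℤ.* + suc m)                               ≡⟨ ≡.cong ℤ.-_ (ℤ.pos-* (suc k) (suc m)) ⟨
      -[1+ k ] ℤ.* + suc m                                    ∎
    where open ≡.≡-Reasoning

  const-∣ : ∀ m p → (∀ i j → + suc m ∣ coeff p i j) → Σ Poly λ p′ → p ≃ (const (+ suc m) ⊗ p′)
  const-∣ m p h = p′ , ≈⇒≃ λ i j → ≡.sym (begin
      coeff (const (+ suc m) ⊗ p′) i j   ≡⟨ coeff-const-⊗ (+ suc m) p′ i j ⟩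
      + suc m ℤ.* coeff p′ i j           ≡⟨ ≡.cong (+ suc m ℤ.*_) (coeff-map i j) ⟩
      + suc m ℤ.* divExact m (coeff p i j) ≡⟨ divExact-correct m _ (h i j) ⟩
      coeff p i j                        ∎)
    where
    open ≡.≡-Reasoning
    p′ : Poly
    p′ = map (map (divExact m)) p
    lookupD-map : ∀ {A : Set} (z : A) (f : A → A) → f z ≡ z → ∀ l i → lookupD z (map f l) i ≡ f (lookupD z l i)
    lookupD-map z f fz [] i = ≡.sym fz
    lookupD-map z f fz (a ∷ l) zero = ≡.refl
    lookupD-map z f fz (a ∷ l) (suc i) = lookupD-map z f fz l i
    coeff-map : ∀ i j → coeff p′ i j ≡ divExact m (coeff p i j)
    coeff-map i j = ≡.trans (≡.cong (λ z → lookupD (+ 0) z j) (lookupD-map [] (map (divExact m)) ≡.refl p i))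
                            (lookupD-map (+ 0) (divExact m) ≡.refl (lookupD [] p i) j)

  const-⊗-cancel : ∀ m {p r} → (const (+ suc m) ⊗ p) ≃ (const (+ suc m) ⊗ r) → p ≃ r
  const-⊗-cancel m {p} {r} h = ≈⇒≃ λ i j → ℤ.*-cancelˡ-≡ (+ suc m) _ _
    (≡.trans (≡.sym (coeff-const-⊗ (+ suc m) p i j)) (≡.trans (≃⇒≈ h i j) (coeff-const-⊗ (+ suc m) r i j)))

  -- q^g - 1 has content 1, so a common divisor of it and of a nonzero integer is a unit.
  ∣const∧∣qpowMinusOne⇒unit : ∀ g → 1 ≤ g → ∀ m c a b →
    (c ⊗ a) ≃ const (+ suc m) → (c ⊗ b) ≃ qpowMinusOne g → Σ Poly λ a′ → (c ⊗ a′) ≃ 1P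
  ∣const∧∣qpowMinusOne⇒unit g g≥1 m c a b ca cb = a′ , const-⊗-cancel m (begin
      const (+ suc m) ⊗ (c ⊗ a′)   ≈⟨ solve 3 (λ m c a → m :* (c :* a) := c :* (m :* a)) ≃-refl (const (+ suc m)) c a′ ⟩
      c ⊗ (const (+ suc m) ⊗ a′)   ≈⟨ ⊗-congˡ c (≃-sym a≃ma′) ⟩
      c ⊗ a                        ≈⟨ ca ⟩
      const (+ suc m)              ≈⟨ ⊗-identityʳ (const (+ suc m)) ⟨
      const (+ suc m) ⊗ 1P         ∎)
    where
    open SetoidReasoning ≃-setoid
    [qᵍ-1]a≃mb : (qpowMinusOne g ⊗ a) ≃ (const (+ suc m) ⊗ b)
    [qᵍ-1]a≃mb = begin
      qpowMinusOne g ⊗ a       ≈⟨ ⊗-congʳ a (≃-sym cb) ⟩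
      (c ⊗ b) ⊗ a              ≈⟨ solve 3 (λ c b a → (c :* b) :* a := (c :* a) :* b) ≃-refl c b a ⟩
      (c ⊗ a) ⊗ b              ≈⟨ ⊗-congʳ b ca ⟩
      const (+ suc m) ⊗ b      ∎
    a/m : Σ Poly λ a′ → a ≃ (const (+ suc m) ⊗ a′)
    a/m = const-∣ m a (∣-coeff g g≥1 (+ suc m) a b [qᵍ-1]a≃mb)
    a′ : Poly
    a′ = proj₁ a/m
    a≃ma′ : a ≃ (const (+ suc m) ⊗ a′)
    a≃ma′ = proj₂ a/m

  qpowMinusOne-⊗-cancelˡ : ∀ g → 1 ≤ g → ∀ {p r} → (qpowMinusOne g ⊗ p) ≃ (qpowMinusOne g ⊗ r) → p ≃ r
  qpowMinusOne-⊗-cancelˡ g g≥1 {p} {r} h = begin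
      p                  ≈⟨ solve 2 (λ p r → p := (p :+ :- r) :+ r) ≃-refl p r ⟩
      (p ⊕ (⊖ r)) ⊕ r    ≈⟨ ⊕-congʳ r (qpowMinusOne-⊗-cancel g g≥1 (p ⊕ (⊖ r)) difference≃0) ⟩
      0P ⊕ r             ≈⟨ ⊕-identityˡ r ⟩
      r                  ∎
    where
    open SetoidReasoning ≃-setoid
    difference≃0 : (qpowMinusOne g ⊗ (p ⊕ (⊖ r))) ≃ 0P
    difference≃0 = begin
      qpowMinusOne g ⊗ (p ⊕ (⊖ r))                        ≈⟨ solve 3 (λ a p r → a :* (p :+ :- r) := a :* p :+ :- (a :* r)) ≃-refl (qpowMinusOne g) p r ⟩
      (qpowMinusOne g ⊗ p) ⊕ (⊖ (qpowMinusOne g ⊗ r))     ≈⟨ ⊕-congʳ (⊖ (qpowMinusOne g ⊗ r)) h ⟩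
      (qpowMinusOne g ⊗ r) ⊕ (⊖ (qpowMinusOne g ⊗ r))     ≈⟨ ⊖-inverseʳ (qpowMinusOne g ⊗ r) ⟩
      0P                                                  ∎

module AdmissibleDenominators where
  open import Data.Nat as ℕ using (ℕ; zero; suc; _≤_; _∸_)
  import Data.Nat.Properties as ℕ
  open import Data.Integer as ℤ using (ℤ; +_)
  import Data.Integer.Properties as ℤ
  open import Data.List using ([]; _∷_)
  open import Data.Product using (Σ; _,_; proj₁; proj₂)
  open import Data.Sum using (inj₁; inj₂)
  open import Relation.Binary.PropositionalEquality as ≡ using (_≡_; _≢_)
  open import Relation.Nullary using (¬_)
  open import Defs
  open Bivariate
  open QPowerMinusOne
  import Relation.Binary.Reasoning.Setoid as SetoidReasoning

  at-q=2 : Poly → PolyX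
  at-q=2 = ℤ[x][q].eval (+ 2 ∷ [])

  value : Poly → ℤ
  value p = ℤ[x].eval (+ 0) (at-q=2 p)

  private
    module Evalq = ℤ[x][q].Evaluation (+ 2 ∷ [])
    module Evalx = ℤ[x].Evaluation (+ 0)

  value-cong : ∀ {p r} → p ≃ r → value p ≡ value r
  value-cong h = Evalx.eval-cong (Evalq.eval-cong h)

  value-⊗ : ∀ p r → value (p ⊗ r) ≡ value p ℤ.* value r
  value-⊗ p r = ≡.trans (Evalx.eval-cong (Evalq.eval-mul p r)) (Evalx.eval-mul (at-q=2 p) (at-q=2 r))

  value-⊖ : ∀ p → value (⊖ p) ≡ ℤ.- value p
  value-⊖ p = ≡.trans (Evalx.eval-cong (Evalq.eval-neg p)) (Evalx.eval-neg (at-q=2 p))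

  value-⊕ : ∀ p r → value (p ⊕ r) ≡ value p ℤ.+ value r
  value-⊕ p r = ≡.trans (Evalx.eval-cong (Evalq.eval-add p r)) (Evalx.eval-add (at-q=2 p) (at-q=2 r))

  value-qpow : ∀ j → value (qpow j) ≡ + (2 ℕ.^ j)
  value-qpow zero = ≡.refl
  value-qpow (suc j) = begin
      value (qpow (suc j))        ≡⟨ value-cong (≃-sym (qpow-⊗ 1 (qpow j))) ⟩
      value (qpow 1 ⊗ qpow j)     ≡⟨ value-⊗ (qpow 1) (qpow j) ⟩
      + 2 ℤ.* value (qpow j)      ≡⟨ ≡.cong (+ 2 ℤ.*_) (value-qpow j) ⟩
      + 2 ℤ.* + (2 ℕ.^ j)         ≡⟨ ℤ.pos-* 2 (2 ℕ.^ j) ⟨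
      + (2 ℕ.^ suc j)             ∎
    where open ≡.≡-Reasoning

  value-qpowMinusOne≢0 : ∀ {j} → 1 ≤ j → value (qpowMinusOne j) ≢ + 0
  value-qpowMinusOne≢0 {j} j≥1 eq = ℕ.<⇒≢ 1<2ʲ (≡.sym (ℤ.+-injective (ℤ.i-j≡0⇒i≡j _ _ 2ʲ-1≡0)))
    where
    2ʲ-1≡0 : + (2 ℕ.^ j) ℤ.- + 1 ≡ + 0
    2ʲ-1≡0 = ≡.trans (≡.sym (≡.trans (value-⊕ (qpow j) (⊖ 1P)) (≡.cong₂ ℤ._+_ (value-qpow j) (value-⊖ 1P)))) eq
    1<2ʲ : 1 ℕ.< 2 ℕ.^ j
    1<2ʲ = ℕ.^-monoʳ-< 2 (ℕ.s≤s (ℕ.s≤s ℕ.z≤n)) j≥1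

  const-⊗-const : ∀ a b → (const a ⊗ const b) ≃ const (a ℤ.* b)
  const-⊗-const a b = ≈⇒≃ λ i j → ≡.trans (coeff-const-⊗ a (const b) i j) (lemma i j)
    where
    lemma : ∀ i j → a ℤ.* coeff (const b) i j ≡ coeff (const (a ℤ.* b)) i j
    lemma zero zero = ≡.refl
    lemma zero (suc j) = ℤ.*-zeroʳ a
    lemma (suc i) j = ℤ.*-zeroʳ a

  module Modulo (P : Poly) (n : ℕ) (n≥1 : 1 ≤ n) (P∣qⁿ-1 : Σ Poly λ R → qpowMinusOne n ≃ (P ⊗ R)) where

    R₀ : Poly
    R₀ = proj₁ P∣qⁿ-1

    -- K is invertible modulo P up to a nonzero integer; its value at x = 0, q = 2 witnesses K ≠ 0.
    record Admissible (K : Poly) : Set where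
      constructor admissible
      field
        value≢0 : value K ≢ + 0
        u v : Poly
        m : ℕ
        bezout : ((u ⊗ K) ⊕ (v ⊗ P)) ≃ const (+ suc m)

    abstract
      Admissible-cong : ∀ {K K′} → K ≃ K′ → Admissible K → Admissible K′
      Admissible-cong h (admissible ne u v m b) =
        admissible (λ z → ne (≡.trans (value-cong h) z)) u v m (≃-trans (⊕-congʳ (v ⊗ P) (⊗-congˡ u (≃-sym h))) b)

    Admissible-1P : Admissible 1P
    Admissible-1P = admissible (λ ()) 1P 0P 0 (≃-trans (⊕-cong (⊗-identityˡ 1P) (⊗-zeroˡ P)) (⊕-identityʳ 1P))

    abstract
      Admissible-⊗ : ∀ {K₁ K₂} → Admissible K₁ → Admissible K₂ → Admissible (K₁ ⊗ K₂)
      Admissible-⊗ {K₁} {K₂} (admissible ne₁ u₁ v₁ m₁ b₁) (admissible ne₂ u₂ v₂ m₂ b₂) =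
        admissible ne (u₁ ⊗ u₂) v (m₂ ℕ.+ m₁ ℕ.* suc m₂) bezout
        where
        ne : value (K₁ ⊗ K₂) ≢ + 0
        ne z with ℤ.i*j≡0⇒i≡0∨j≡0 (value K₁) (≡.trans (≡.sym (value-⊗ K₁ K₂)) z)
        ... | inj₁ z₁ = ne₁ z₁
        ... | inj₂ z₂ = ne₂ z₂
        v : Poly
        v = ((v₁ ⊗ (u₂ ⊗ K₂)) ⊕ ((u₁ ⊗ K₁) ⊗ v₂)) ⊕ ((v₁ ⊗ v₂) ⊗ P)
        bezout : (((u₁ ⊗ u₂) ⊗ (K₁ ⊗ K₂)) ⊕ (v ⊗ P)) ≃ const (+ suc (m₂ ℕ.+ m₁ ℕ.* suc m₂))
        bezout = ≃-trans
          (solve 7 (λ u₁ u₂ k₁ k₂ v₁ v₂ p →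
             (u₁ :* u₂) :* (k₁ :* k₂) :+ ((v₁ :* (u₂ :* k₂) :+ (u₁ :* k₁) :* v₂) :+ (v₁ :* v₂) :* p) :* p
             := (u₁ :* k₁ :+ v₁ :* p) :* (u₂ :* k₂ :+ v₂ :* p)) ≃-refl u₁ u₂ K₁ K₂ v₁ v₂ P)
          (≃-trans (⊗-cong b₁ b₂)
            (≃-trans (const-⊗-const (+ suc m₁) (+ suc m₂)) (≃-reflexive (≡.cong const (≡.sym (ℤ.pos-* (suc m₁) (suc m₂)))))))

      Admissible-⊖ : ∀ {K} → Admissible K → Admissible (⊖ K)
      Admissible-⊖ {K} (admissible ne u v m b) =
        admissible (λ z → ne (ℤ.neg-injective (≡.trans (≡.sym (value-⊖ K)) z))) (⊖ u) v m
          (≃-trans (⊕-congʳ (v ⊗ P) (solve 2 (λ u k → :- u :* :- k := u :* k) ≃-refl u K)) b)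

    Admissible-q : Admissible (qpow 1)
    Admissible-q = admissible (λ ()) (qpow (n ∸ 1)) (⊖ R₀) 0 (begin
        (qpow (n ∸ 1) ⊗ qpow 1) ⊕ ((⊖ R₀) ⊗ P)  ≈⟨ ⊕-cong (≃-sym (qpow-+ (n ∸ 1) 1)) (solve 2 (λ p r → (:- r) :* p := :- (p :* r)) ≃-refl P R₀) ⟩
        qpow (n ∸ 1 ℕ.+ 1) ⊕ (⊖ (P ⊗ R₀))       ≡⟨ ≡.cong (λ k → qpow k ⊕ (⊖ (P ⊗ R₀))) (ℕ.m∸n+n≡m n≥1) ⟩
        qpow n ⊕ (⊖ (P ⊗ R₀))                   ≈⟨ ⊕-congˡ (qpow n) (⊖-cong (≃-sym (proj₂ P∣qⁿ-1))) ⟩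
        qpow n ⊕ (⊖ qpowMinusOne n)             ≈⟨ solve 2 (λ a o → a :+ :- (a :+ :- o) := o) ≃-refl (qpow n) 1P ⟩
        1P                                      ∎)
      where open SetoidReasoning ≃-setoid

    Admissible-qpow : ∀ j → Admissible (qpow j)
    Admissible-qpow zero = Admissible-1P
    Admissible-qpow (suc j) = Admissible-cong (qpow-⊗ 1 (qpow j)) (Admissible-⊗ Admissible-q (Admissible-qpow j))

    Admissible⇒Coprime : ∀ {K} → Admissible K → Coprime K P
    Admissible⇒Coprime {K} (admissible _ u v m b) c (m₁ , K≈cm₁) (m₂ , P≈cm₂) =
      proj₁ unit , ≃⇒≈ (≃-sym (proj₂ unit))
      where
      ca : (c ⊗ ((u ⊗ m₁) ⊕ (v ⊗ m₂))) ≃ const (+ suc m)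
      ca = ≃-trans (solve 5 (λ c u v m₁ m₂ → c :* (u :* m₁ :+ v :* m₂) := u :* (c :* m₁) :+ v :* (c :* m₂)) ≃-refl c u v m₁ m₂)
             (≃-trans (⊕-cong (⊗-congˡ u (≃-sym (≈⇒≃ {K} {c ⊗ m₁} K≈cm₁))) (⊗-congˡ v (≃-sym (≈⇒≃ {P} {c ⊗ m₂} P≈cm₂)))) b)
      cb : (c ⊗ (m₂ ⊗ R₀)) ≃ qpowMinusOne n
      cb = ≃-trans (≃-sym (⊗-assoc c m₂ R₀)) (≃-trans (⊗-congʳ R₀ (≃-sym (≈⇒≃ {P} {c ⊗ m₂} P≈cm₂))) (≃-sym (proj₂ P∣qⁿ-1)))
      unit : Σ Poly λ a′ → (c ⊗ a′) ≃ 1P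
      unit = ∣const∧∣qpowMinusOne⇒unit n n≥1 m c ((u ⊗ m₁) ⊕ (v ⊗ m₂)) (m₂ ⊗ R₀) ca cb

    Admissible⇒≉0 : ∀ {K} → Admissible K → ¬ (K ≈ 0P)
    Admissible⇒≉0 {K} (admissible ne _ _ _ _) z = ne (value-cong {K} {0P} (≈⇒≃ z))

module GeometricSums where
  open import Data.Nat as ℕ using (ℕ; zero; suc)
  import Data.Nat.Properties as ℕ
  open import Data.Nat.GCD using (module Bézout)
  open import Data.Integer as ℤ using (+_)
  open import Data.Product using (Σ; _,_)
  open import Relation.Binary.PropositionalEquality as ≡ using (_≡_)
  import Relation.Binary.Reasoning.Setoid as SetoidReasoning
  open import Defs
  open Bivariate
  open QPowerMinusOne
  open SetoidReasoning ≃-setoid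

  geomSum : ℕ → ℕ → Poly
  geomSum a zero = 0P
  geomSum a (suc k) = geomSum a k ⊕ qpow (a ℕ.* k)

  qpowMinusOne-+ : ∀ a b → qpowMinusOne (a ℕ.+ b) ≃ ((qpow a ⊗ qpowMinusOne b) ⊕ qpowMinusOne a)
  qpowMinusOne-+ a b = ≃-trans (⊕-congʳ (⊖ 1P) (qpow-+ a b))
    (solve 2 (λ A B → A :* B :+ :- con (+ 1) := A :* (B :+ :- con (+ 1)) :+ (A :+ :- con (+ 1))) ≃-refl (qpow a) (qpow b))

  qpowMinusOne-⊗-geomSum : ∀ a k → (qpowMinusOne a ⊗ geomSum a k) ≃ qpowMinusOne (a ℕ.* k)
  qpowMinusOne-⊗-geomSum a zero = begin
      qpowMinusOne a ⊗ 0P     ≈⟨ ⊗-zeroʳ (qpowMinusOne a) ⟩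
      0P                      ≈⟨ ⊖-inverseʳ 1P ⟨
      qpowMinusOne 0          ≡⟨ ≡.cong qpowMinusOne (ℕ.*-zeroʳ a) ⟨
      qpowMinusOne (a ℕ.* 0)  ∎
  qpowMinusOne-⊗-geomSum a (suc k) = begin
      qpowMinusOne a ⊗ (geomSum a k ⊕ qpow (a ℕ.* k))
        ≈⟨ ⊗-distribˡ (qpowMinusOne a) (geomSum a k) (qpow (a ℕ.* k)) ⟩
      (qpowMinusOne a ⊗ geomSum a k) ⊕ (qpowMinusOne a ⊗ qpow (a ℕ.* k))
        ≈⟨ ⊕-congʳ (qpowMinusOne a ⊗ qpow (a ℕ.* k)) (qpowMinusOne-⊗-geomSum a k) ⟩
      qpowMinusOne (a ℕ.* k) ⊕ (qpowMinusOne a ⊗ qpow (a ℕ.* k))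
        ≈⟨ solve 2 (λ A B → (B :+ :- con (+ 1)) :+ (A :+ :- con (+ 1)) :* B := A :* B :+ :- con (+ 1)) ≃-refl (qpow a) (qpow (a ℕ.* k)) ⟩
      (qpow a ⊗ qpow (a ℕ.* k)) ⊕ (⊖ 1P)
        ≈⟨ ⊕-congʳ (⊖ 1P) (qpow-+ a (a ℕ.* k)) ⟨
      qpowMinusOne (a ℕ.+ a ℕ.* k)
        ≡⟨ ≡.cong qpowMinusOne (ℕ.*-suc a k) ⟨
      qpowMinusOne (a ℕ.* suc k) ∎

  const-suc : ∀ k → const (+ suc k) ≃ (const (+ k) ⊕ 1P)
  const-suc k = ≈⇒≃ λ i j → ≡.sym (≡.trans (coeff-⊕ (const (+ k)) 1P i j) (lemma i j))
    where
    lemma : ∀ i j → coeff (const (+ k)) i j ℤ.+ coeff 1P i j ≡ coeff (const (+ suc k)) i j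
    lemma zero zero = ≡.cong +_ (ℕ.+-comm k 1)
    lemma zero (suc j) = ≡.refl
    lemma (suc i) j = ≡.refl

  const-0 : const (+ 0) ≃ 0P
  const-0 = ≈⇒≃ λ where
    zero zero → ≡.refl
    zero (suc j) → ≡.refl
    (suc i) j → ≡.refl

  -- Each term q^(a i) is 1 modulo q^a - 1, with quotient geomSum a i.
  geomSum≡length : ∀ a k → Σ Poly λ T → geomSum a k ≃ (const (+ k) ⊕ (qpowMinusOne a ⊗ T))
  geomSum≡length a zero = 0P , ≃-sym (≃-trans (⊕-cong const-0 (⊗-zeroʳ (qpowMinusOne a))) (⊕-identityʳ 0P))
  geomSum≡length a (suc k) with geomSum≡length a k
  ... | T , h = T ⊕ geomSum a k , (begin
      geomSum a k ⊕ qpow (a ℕ.* k)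
        ≈⟨ ⊕-cong h (solve 2 (λ A o → A := o :+ (A :+ :- o)) ≃-refl (qpow (a ℕ.* k)) 1P) ⟩
      (const (+ k) ⊕ (qpowMinusOne a ⊗ T)) ⊕ (1P ⊕ qpowMinusOne (a ℕ.* k))
        ≈⟨ ⊕-congˡ (const (+ k) ⊕ (qpowMinusOne a ⊗ T)) (⊕-congˡ 1P (≃-sym (qpowMinusOne-⊗-geomSum a k))) ⟩
      (const (+ k) ⊕ (qpowMinusOne a ⊗ T)) ⊕ (1P ⊕ (qpowMinusOne a ⊗ geomSum a k))
        ≈⟨ solve 5 (λ c m t o g → (c :+ m :* t) :+ (o :+ m :* g) := (c :+ o) :+ m :* (t :+ g)) ≃-refl (const (+ k)) (qpowMinusOne a) T 1P (geomSum a k) ⟩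
      (const (+ k) ⊕ 1P) ⊕ (qpowMinusOne a ⊗ (T ⊕ geomSum a k))
        ≈⟨ ⊕-congʳ (qpowMinusOne a ⊗ (T ⊕ geomSum a k)) (const-suc k) ⟨
      const (+ suc k) ⊕ (qpowMinusOne a ⊗ (T ⊕ geomSum a k)) ∎)

  qpowMinusOne-combination : ∀ g J n x y → g ℕ.+ y ℕ.* n ≡ x ℕ.* J →
    ((geomSum J x ⊗ qpowMinusOne J) ⊕ ((⊖ (qpow g ⊗ geomSum n y)) ⊗ qpowMinusOne n)) ≃ qpowMinusOne g
  qpowMinusOne-combination g J n x y eq = begin
      (geomSum J x ⊗ qpowMinusOne J) ⊕ ((⊖ (qpow g ⊗ geomSum n y)) ⊗ qpowMinusOne n)
        ≈⟨ ⊕-cong (⊗-comm (geomSum J x) (qpowMinusOne J))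
                  (solve 3 (λ G y m → (:- (G :* y)) :* m := :- (G :* (m :* y))) ≃-refl (qpow g) (geomSum n y) (qpowMinusOne n)) ⟩
      (qpowMinusOne J ⊗ geomSum J x) ⊕ (⊖ (qpow g ⊗ (qpowMinusOne n ⊗ geomSum n y)))
        ≈⟨ ⊕-cong (qpowMinusOne-⊗-geomSum J x) (⊖-cong (⊗-congˡ (qpow g) (qpowMinusOne-⊗-geomSum n y))) ⟩
      qpowMinusOne (J ℕ.* x) ⊕ (⊖ (qpow g ⊗ qpowMinusOne (n ℕ.* y)))
        ≡⟨ ≡.cong (λ e → qpowMinusOne e ⊕ (⊖ (qpow g ⊗ qpowMinusOne (n ℕ.* y)))) Jx≡g+ny ⟩
      qpowMinusOne (g ℕ.+ n ℕ.* y) ⊕ (⊖ (qpow g ⊗ qpowMinusOne (n ℕ.* y)))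
        ≈⟨ ⊕-congʳ (⊖ (qpow g ⊗ qpowMinusOne (n ℕ.* y))) (qpowMinusOne-+ g (n ℕ.* y)) ⟩
      ((qpow g ⊗ qpowMinusOne (n ℕ.* y)) ⊕ qpowMinusOne g) ⊕ (⊖ (qpow g ⊗ qpowMinusOne (n ℕ.* y)))
        ≈⟨ solve 2 (λ A B → (A :+ B) :+ :- A := B) ≃-refl (qpow g ⊗ qpowMinusOne (n ℕ.* y)) (qpowMinusOne g) ⟩
      qpowMinusOne g ∎
    where
    Jx≡g+ny : J ℕ.* x ≡ g ℕ.+ n ℕ.* y
    Jx≡g+ny = ≡.trans (ℕ.*-comm J x) (≡.trans (≡.sym eq) (≡.cong (g ℕ.+_) (ℕ.*-comm y n)))

  qpowMinusOne-bezout : ∀ {g J n} → Bézout.Identity g J n →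
    Σ Poly λ α → Σ Poly λ β → ((α ⊗ qpowMinusOne J) ⊕ (β ⊗ qpowMinusOne n)) ≃ qpowMinusOne g
  qpowMinusOne-bezout {g} {J} {n} (Bézout.+- x y eq) =
    geomSum J x , ⊖ (qpow g ⊗ geomSum n y) , qpowMinusOne-combination g J n x y eq
  qpowMinusOne-bezout {g} {J} {n} (Bézout.-+ x y eq) =
    ⊖ (qpow g ⊗ geomSum J x) , geomSum n y ,
    ≃-trans (⊕-comm ((⊖ (qpow g ⊗ geomSum J x)) ⊗ qpowMinusOne J) (geomSum n y ⊗ qpowMinusOne n))
            (qpowMinusOne-combination g n J y x eq)

module CyclotomicFactors (Φ : ℕ → Poly) (isCyclotomic : IsCyclotomic Φ) where
  open import Data.Nat as ℕ using (ℕ; zero; suc; _<_; _≤_; z≤n; s≤s; _∸_)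
  import Data.Nat.Properties as ℕ
  open import Data.Nat.Divisibility using (_∣_; _∣?_; divides; ∣-trans; ∣-refl; ∣⇒≤)
  open import Data.Nat.GCD using (gcd; gcd-GCD; gcd[m,n]∣m; gcd[m,n]∣n; module Bézout)
  open import Data.Integer as ℤ using (+_)
  open import Data.List using (List; []; _∷_; map; filter; upTo; _++_)
  import Data.List.Properties as List
  open import Data.Product using (Σ; _,_; proj₁; proj₂)
  open import Data.Empty using (⊥-elim)
  open import Relation.Binary.PropositionalEquality as ≡ using (_≡_)
  open import Relation.Nullary using (yes; no; ¬_)
  import Relation.Binary.Reasoning.Setoid as SetoidReasoning
  open import Defs
  open Bivariate
  open QPowerMinusOne
  open GeometricSums
  open AdmissibleDenominators

  range : ℕ → List ℕ
  range k = map suc (upTo k)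

  divisorsAmong : ℕ → List ℕ → List ℕ
  divisorsAmong n = filter (_∣? n)

  prodΦ : List ℕ → Poly
  prodΦ ds = prodP (map Φ ds)

  range-suc : ∀ k → range (suc k) ≡ range k ++ (suc k ∷ [])
  range-suc k = ≡.trans (≡.cong (map suc) (≡.sym (List.upTo-∷ʳ k))) (List.map-++ suc (upTo k) (k ∷ []))

  prodΦ-++ : ∀ xs ys → prodΦ (xs ++ ys) ≃ (prodΦ xs ⊗ prodΦ ys)
  prodΦ-++ [] ys = ≃-sym (⊗-identityˡ (prodΦ ys))
  prodΦ-++ (x ∷ xs) ys = ≃-trans (⊗-congˡ (Φ x) (prodΦ-++ xs ys)) (≃-sym (⊗-assoc (Φ x) (prodΦ xs) (prodΦ ys)))

  prodΦ-divisorsAmong-∣ : ∀ {g n} → g ∣ n → ∀ xs →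
    Σ Poly λ R → prodΦ (divisorsAmong n xs) ≃ (prodΦ (divisorsAmong g xs) ⊗ R)
  prodΦ-divisorsAmong-∣ g∣n [] = 1P , ≃-sym (⊗-identityʳ 1P)
  prodΦ-divisorsAmong-∣ {g} {n} g∣n (x ∷ xs) with prodΦ-divisorsAmong-∣ g∣n xs | x ∣? g | x ∣? n
  ... | R , h | yes x∣g | yes x∣n = R , ≃-trans (⊗-congˡ (Φ x) h) (≃-sym (⊗-assoc (Φ x) (prodΦ (divisorsAmong g xs)) R))
  ... | R , h | yes x∣g | no x∤n = ⊥-elim (x∤n (∣-trans x∣g g∣n))
  ... | R , h | no x∤g | yes x∣n = Φ x ⊗ R , ≃-trans (⊗-congˡ (Φ x) h)
    (solve 3 (λ f p r → f :* (p :* r) := p :* (f :* r)) ≃-refl (Φ x) (prodΦ (divisorsAmong g xs)) R)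
  ... | R , h | no x∤g | no x∤n = R , h

  divisorsAmong-range-+ : ∀ g → 1 ≤ g → ∀ t → divisorsAmong g (range (g ℕ.+ t)) ≡ divisors g
  divisorsAmong-range-+ g g≥1 zero = ≡.cong (λ k → divisorsAmong g (range k)) (ℕ.+-identityʳ g)
  divisorsAmong-range-+ g g≥1 (suc t) = begin
      divisorsAmong g (range (g ℕ.+ suc t))                     ≡⟨ ≡.cong (λ k → divisorsAmong g (range k)) (ℕ.+-suc g t) ⟩
      divisorsAmong g (range (suc (g ℕ.+ t)))                   ≡⟨ ≡.cong (divisorsAmong g) (range-suc (g ℕ.+ t)) ⟩
      divisorsAmong g (range (g ℕ.+ t) ++ (suc (g ℕ.+ t) ∷ [])) ≡⟨ List.filter-++ (_∣? g) (range (g ℕ.+ t)) _ ⟩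
      divisorsAmong g (range (g ℕ.+ t)) ++ divisorsAmong g (suc (g ℕ.+ t) ∷ [])
        ≡⟨ ≡.cong (divisorsAmong g (range (g ℕ.+ t)) ++_) (List.filter-reject (_∣? g) too-big) ⟩
      divisorsAmong g (range (g ℕ.+ t)) ++ []                   ≡⟨ List.++-identityʳ _ ⟩
      divisorsAmong g (range (g ℕ.+ t))                         ≡⟨ divisorsAmong-range-+ g g≥1 t ⟩
      divisors g                                                ∎
    where
    open ≡.≡-Reasoning
    too-big : ¬ (suc (g ℕ.+ t) ∣ g)
    too-big h = ℕ.<⇒≱ (s≤s (ℕ.m≤m+n g t)) (∣⇒≤ ⦃ ℕ.>-nonZero g≥1 ⦄ h)

  module Order (n′ : ℕ) where
    n : ℕ
    n = suc n′

    qⁿ-1≃properDivisors⊗Φ : qpowMinusOne n ≃ (prodΦ (divisorsAmong n (range n′)) ⊗ Φ n)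
    qⁿ-1≃properDivisors⊗Φ = begin
        qpowMinusOne n                                              ≈⟨ ≈⇒≃ {qpowMinusOne n} {prodΦ (divisors n)} (isCyclotomic n (s≤s z≤n)) ⟩
        prodΦ (divisorsAmong n (range n))                           ≡⟨ ≡.cong (λ ds → prodΦ (divisorsAmong n ds)) (range-suc n′) ⟩
        prodΦ (divisorsAmong n (range n′ ++ (n ∷ [])))              ≡⟨ ≡.cong prodΦ (List.filter-++ (_∣? n) (range n′) (n ∷ [])) ⟩
        prodΦ (divisorsAmong n (range n′) ++ divisorsAmong n (n ∷ []))
          ≡⟨ ≡.cong (λ ds → prodΦ (divisorsAmong n (range n′) ++ ds)) (List.filter-accept (_∣? n) ∣-refl) ⟩
        prodΦ (divisorsAmong n (range n′) ++ (n ∷ []))              ≈⟨ prodΦ-++ (divisorsAmong n (range n′)) (n ∷ []) ⟩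
        prodΦ (divisorsAmong n (range n′)) ⊗ (Φ n ⊗ 1P)             ≈⟨ ⊗-congˡ (prodΦ (divisorsAmong n (range n′))) (⊗-identityʳ (Φ n)) ⟩
        prodΦ (divisorsAmong n (range n′)) ⊗ Φ n                    ∎
      where open SetoidReasoning ≃-setoid

    Φ∣qⁿ-1 : Σ Poly λ R → qpowMinusOne n ≃ (Φ n ⊗ R)
    Φ∣qⁿ-1 = prodΦ (divisorsAmong n (range n′)) , ≃-trans qⁿ-1≃properDivisors⊗Φ (⊗-comm _ (Φ n))

    open Modulo (Φ n) n (s≤s z≤n) Φ∣qⁿ-1 public

    qᵍ-1·Φ∣qⁿ-1 : ∀ {g} → g ∣ n → 1 ≤ g → g < n → Σ Poly λ W → qpowMinusOne n ≃ (qpowMinusOne g ⊗ (W ⊗ Φ n))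
    qᵍ-1·Φ∣qⁿ-1 {g} g∣n g≥1 g<n with prodΦ-divisorsAmong-∣ g∣n (range n′)
    ... | W , h = W , (begin
        qpowMinusOne n                                    ≈⟨ qⁿ-1≃properDivisors⊗Φ ⟩
        prodΦ (divisorsAmong n (range n′)) ⊗ Φ n          ≈⟨ ⊗-congʳ (Φ n) h ⟩
        (prodΦ (divisorsAmong g (range n′)) ⊗ W) ⊗ Φ n    ≡⟨ ≡.cong (λ ds → (prodΦ ds ⊗ W) ⊗ Φ n) divisors-g ⟩
        (prodΦ (divisors g) ⊗ W) ⊗ Φ n                    ≈⟨ ⊗-congʳ (Φ n) (⊗-congʳ W qᵍ-1≃prodΦ) ⟨
        (qpowMinusOne g ⊗ W) ⊗ Φ n                        ≈⟨ ⊗-assoc (qpowMinusOne g) W (Φ n) ⟩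
        qpowMinusOne g ⊗ (W ⊗ Φ n)                        ∎)
      where
      open SetoidReasoning ≃-setoid
      g≤n′ : g ≤ n′
      g≤n′ = ℕ.≤-pred g<n
      qᵍ-1≃prodΦ : qpowMinusOne g ≃ prodΦ (divisors g)
      qᵍ-1≃prodΦ = ≈⇒≃ {qpowMinusOne g} {prodΦ (divisors g)} (isCyclotomic g g≥1)
      divisors-g : divisorsAmong g (range n′) ≡ divisors g
      divisors-g = ≡.trans (≡.cong (λ k → divisorsAmong g (range k)) (≡.sym (ℕ.m+[n∸m]≡n g≤n′)))
                           (divisorsAmong-range-+ g g≥1 (n′ ∸ g))

    Φ∣geomSum : ∀ {g k} → n ≡ k ℕ.* g → g < n → Σ Poly λ W → geomSum g k ≃ (W ⊗ Φ n)
    Φ∣geomSum {zero} {k} n≡k*0 _ = ⊥-elim (ℕ.0≢1+n (≡.trans (≡.sym (ℕ.*-zeroʳ k)) (≡.sym n≡k*0)))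
    Φ∣geomSum {g@(suc _)} {k} n≡kg g<n with qᵍ-1·Φ∣qⁿ-1 (divides k n≡kg) (s≤s z≤n) g<n
    ... | W , h = W , qpowMinusOne-⊗-cancelˡ g (s≤s z≤n) (begin
        qpowMinusOne g ⊗ geomSum g k   ≈⟨ qpowMinusOne-⊗-geomSum g k ⟩
        qpowMinusOne (g ℕ.* k)         ≡⟨ ≡.cong qpowMinusOne (≡.trans (ℕ.*-comm g k) (≡.sym n≡kg)) ⟩
        qpowMinusOne n                 ≈⟨ h ⟩
        qpowMinusOne g ⊗ (W ⊗ Φ n)     ∎)
      where open SetoidReasoning ≃-setoid

    Admissible-qpowMinusOne : ∀ {J} → 1 ≤ J → ¬ (n ∣ J) → Admissible (qpowMinusOne J)
    Admissible-qpowMinusOne {J} J≥1 n∤J with gcd[m,n]∣n J n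
    ... | divides zero ()
    ... | divides k@(suc k′) n≡kg = admissible (value-qpowMinusOne≢0 J≥1) u v k′ (begin
        (u ⊗ qpowMinusOne J) ⊕ (v ⊗ Φ n)
          ≈⟨ solve 7 (λ t a j w r b f → (:- (t :* a)) :* j :+ (w :+ :- ((t :* b) :* r)) :* f
                                       := w :* f :+ :- (t :* (a :* j :+ b :* (f :* r))))
                     ≃-refl T α (qpowMinusOne J) W R₀ β (Φ n) ⟩
        (W ⊗ Φ n) ⊕ (⊖ (T ⊗ ((α ⊗ qpowMinusOne J) ⊕ (β ⊗ (Φ n ⊗ R₀)))))
          ≈⟨ ⊕-cong (≃-sym S≃WΦ) (⊖-cong (⊗-congˡ T (⊕-congˡ (α ⊗ qpowMinusOne J) (⊗-congˡ β (≃-sym (proj₂ Φ∣qⁿ-1)))))) ⟩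
        S ⊕ (⊖ (T ⊗ ((α ⊗ qpowMinusOne J) ⊕ (β ⊗ qpowMinusOne n))))
          ≈⟨ ⊕-cong S≡k (⊖-cong (⊗-congˡ T bez)) ⟩
        (const (+ k) ⊕ (qpowMinusOne g ⊗ T)) ⊕ (⊖ (T ⊗ qpowMinusOne g))
          ≈⟨ solve 3 (λ c a t → (c :+ a :* t) :+ :- (t :* a) := c) ≃-refl (const (+ k)) (qpowMinusOne g) T ⟩
        const (+ k) ∎)
      where
      open SetoidReasoning ≃-setoid
      g : ℕ
      g = gcd J n
      g<n : g < n
      g<n = ℕ.≤∧≢⇒< (∣⇒≤ (gcd[m,n]∣n J n)) (λ g≡n → n∤J (≡.subst (_∣ J) g≡n (gcd[m,n]∣m J n)))
      S T W α β : Poly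
      S = geomSum g k
      T = proj₁ (geomSum≡length g k)
      W = proj₁ (Φ∣geomSum n≡kg g<n)
      α = proj₁ (qpowMinusOne-bezout (Bézout.identity (gcd-GCD J n)))
      β = proj₁ (proj₂ (qpowMinusOne-bezout (Bézout.identity (gcd-GCD J n))))
      S≡k : S ≃ (const (+ k) ⊕ (qpowMinusOne g ⊗ T))
      S≡k = proj₂ (geomSum≡length g k)
      S≃WΦ : S ≃ (W ⊗ Φ n)
      S≃WΦ = proj₂ (Φ∣geomSum n≡kg g<n)
      bez : ((α ⊗ qpowMinusOne J) ⊕ (β ⊗ qpowMinusOne n)) ≃ qpowMinusOne g
      bez = proj₂ (proj₂ (qpowMinusOne-bezout (Bézout.identity (gcd-GCD J n))))
      u v : Poly
      u = ⊖ (T ⊗ α)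
      v = W ⊕ (⊖ ((T ⊗ β) ⊗ R₀))

module TerminatingChuVandermonde (R : CommutativeRing 0ℓ 0ℓ) where
  open CommutativeRing R
  open IntegerCoefficientSolver R using (solve; _:=_; _:+_; _:*_; :-_; _:-_; con)
  open import Data.Nat as ℕ using (zero; suc; _<_; _≤_; z≤n; s≤s)
  import Data.Nat.Properties as ℕ
  open import Data.Integer using (+_)
  open import Data.Sum using (inj₁; inj₂)
  open import Relation.Binary.PropositionalEquality as ≡ using (_≡_)
  open import Relation.Binary.Reasoning.Setoid setoid

  pow : Carrier → ℕ → Carrier
  pow a zero = 1#
  pow a (suc k) = pow a k * a

  poch : Carrier → Carrier → ℕ → Carrier
  poch a b zero = 1#
  poch a b (suc k) = poch a b k * (1# - a * pow b k)

  sum : (ℕ → Carrier) → ℕ → Carrier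
  sum f zero = 0#
  sum f (suc k) = sum f k + f k

  pow-cong : ∀ {a b} k → a ≈ b → pow a k ≈ pow b k
  pow-cong zero h = refl
  pow-cong (suc k) h = *-cong (pow-cong k h) h

  pow-distrib-* : ∀ a b k → pow a k * pow b k ≈ pow (a * b) k
  pow-distrib-* a b zero = *-identityˡ 1#
  pow-distrib-* a b (suc k) = begin
    (pow a k * a) * (pow b k * b)  ≈⟨ solve 4 (λ x a y b → (x :* a) :* (y :* b) := (x :* y) :* (a :* b)) refl (pow a k) a (pow b k) b ⟩
    (pow a k * pow b k) * (a * b)  ≈⟨ *-congʳ (pow-distrib-* a b k) ⟩
    pow (a * b) k * (a * b)        ∎

  pow-1# : ∀ k → pow 1# k ≈ 1#
  pow-1# zero = refl
  pow-1# (suc k) = trans (*-identityʳ _) (pow-1# k)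

  pow-+ : ∀ a j k → pow a (j ℕ.+ k) ≈ pow a j * pow a k
  pow-+ a j zero = trans (reflexive (≡.cong (pow a) (ℕ.+-identityʳ j))) (sym (*-identityʳ _))
  pow-+ a j (suc k) = begin
    pow a (j ℕ.+ suc k)      ≡⟨ ≡.cong (pow a) (ℕ.+-suc j k) ⟩
    pow a (j ℕ.+ k) * a      ≈⟨ *-congʳ (pow-+ a j k) ⟩
    (pow a j * pow a k) * a  ≈⟨ *-assoc _ _ _ ⟩
    pow a j * (pow a k * a)  ∎

  pow-pow : ∀ a j k → pow (pow a j) k ≈ pow a (j ℕ.* k)
  pow-pow a j zero = reflexive (≡.cong (pow a) (≡.sym (ℕ.*-zeroʳ j)))
  pow-pow a j (suc k) = begin
    pow (pow a j) k * pow a j    ≈⟨ *-congʳ (pow-pow a j k) ⟩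
    pow a (j ℕ.* k) * pow a j    ≈⟨ *-comm _ _ ⟩
    pow a j * pow a (j ℕ.* k)    ≈⟨ pow-+ a j (j ℕ.* k) ⟨
    pow a (j ℕ.+ j ℕ.* k)        ≡⟨ ≡.cong (pow a) (ℕ.*-suc j k) ⟨
    pow a (j ℕ.* suc k)          ∎

  poch-congˡ : ∀ {a a′} b k → a ≈ a′ → poch a b k ≈ poch a′ b k
  poch-congˡ b zero h = refl
  poch-congˡ b (suc k) h = *-cong (poch-congˡ b k h) (+-congˡ (-‿cong (*-congʳ h)))

  sum-cong : ∀ {f g} l → (∀ k → k < l → f k ≈ g k) → sum f l ≈ sum g l
  sum-cong zero h = refl
  sum-cong (suc l) h = +-cong (sum-cong l (λ k k<l → h k (ℕ.m<n⇒m<1+n k<l))) (h l ℕ.≤-refl)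

  *-identityˡ-≈1# : ∀ {t} → t ≈ 1# → ∀ a → t * a ≈ a
  *-identityˡ-≈1# h a = trans (*-congʳ h) (*-identityˡ a)

  -- w inverts Q and e k inverts (Q;Q)_k, the latter only for k ≤ l, so that partialSum N (suc l)
  -- is Σ_{k ≤ l} (x;Q)_k (Q^-N;Q)_k Q^k / (Q;Q)_k.
  module Sum (Q w x : Carrier) (wQ≈1 : w * Q ≈ 1#) (l : ℕ) (e : ℕ → Carrier)
             (e-inverse : ∀ k → k < suc l → e k * poch Q Q k ≈ 1#) where

    xPoch : ℕ → Carrier
    xPoch k = poch x Q k

    coefficient : ℕ → ℕ → Carrier
    coefficient N k = poch (pow w N) Q k * pow Q k * e k

    partialSum : ℕ → ℕ → Carrier
    partialSum N m = sum (λ k → xPoch k * coefficient N k) m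

    wᵏQᵏ≈1 : ∀ k → pow w k * pow Q k ≈ 1#
    wᵏQᵏ≈1 k = trans (pow-distrib-* w Q k) (trans (pow-cong k wQ≈1) (pow-1# k))

    poch-zero : ∀ a j k → j < k → a * pow Q j ≈ 1# → poch a Q k ≈ 0#
    poch-zero a j (suc k) (s≤s j≤k) h with ℕ.m≤n⇒m<n∨m≡n j≤k
    ... | inj₁ j<k = trans (*-congʳ (poch-zero a j k j<k h)) (zeroˡ _)
    ... | inj₂ ≡.refl = trans (*-congˡ (trans (+-congˡ (-‿cong h)) (-‿inverseʳ 1#))) (zeroʳ _)

    coefficient-zero : ∀ N k → N < k → coefficient N k ≈ 0#
    coefficient-zero N k N<k =
      trans (*-congʳ (trans (*-congʳ (poch-zero (pow w N) N k N<k (wᵏQᵏ≈1 N))) (zeroˡ _))) (zeroˡ _)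

    poch-suc : ∀ a k → poch a Q (suc k) ≈ (1# - a) * poch (a * Q) Q k
    poch-suc a zero = solve 1 (λ a → con (+ 1) :* (con (+ 1) :- a :* con (+ 1)) := (con (+ 1) :- a) :* con (+ 1)) refl a
    poch-suc a (suc k) = begin
      poch a Q (suc k) * (1# - a * (pow Q k * Q))               ≈⟨ *-congʳ (poch-suc a k) ⟩
      ((1# - a) * poch (a * Q) Q k) * (1# - a * (pow Q k * Q))  ≈⟨ solve 4 (λ a p q k → ((con (+ 1) :- a) :* p) :* (con (+ 1) :- a :* (k :* q))
                                                                     := (con (+ 1) :- a) :* (p :* (con (+ 1) :- (a :* q) :* k))) refl a (poch (a * Q) Q k) Q (pow Q k) ⟩
      (1# - a) * (poch (a * Q) Q k * (1# - (a * Q) * pow Q k))  ∎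

    e-suc : ∀ k → suc k < suc l → e k ≈ (1# - Q * pow Q k) * e (suc k)
    e-suc k sk<sl = begin
      e k                                                   ≈⟨ *-identityʳ _ ⟨
      e k * 1#                                              ≈⟨ *-congˡ (e-inverse (suc k) sk<sl) ⟨
      e k * (e (suc k) * (poch Q Q k * (1# - Q * pow Q k))) ≈⟨ solve 4 (λ a b c d → a :* (b :* (c :* d)) := (a :* c) :* (d :* b)) refl (e k) (e (suc k)) (poch Q Q k) _ ⟩
      (e k * poch Q Q k) * ((1# - Q * pow Q k) * e (suc k)) ≈⟨ *-identityˡ-≈1# (e-inverse k (ℕ.<-trans (ℕ.n<1+n k) sk<sl)) _ ⟩
      (1# - Q * pow Q k) * e (suc k)                        ∎

    coefficient-contiguity : ∀ N k → suc k < suc l →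
      coefficient (suc N) (suc k) ≈ pow w (suc k) * coefficient N (suc k) - pow w k * coefficient N k
    coefficient-contiguity N k sk<sl = begin
      poch (wᴺ * w) Q (suc k) * (Qᵏ * Q) * e′          ≈⟨ *-congʳ (*-congʳ (trans (poch-suc (wᴺ * w) k) (*-congˡ (poch-congˡ Q k wᴺwQ≈wᴺ)))) ⟩
      ((1# - wᴺ * w) * P) * (Qᵏ * Q) * e′              ≈⟨ solve 6 (λ z w p k q e → ((con (+ 1) :- z :* w) :* p) :* (k :* q) :* e
                                                             := p :* e :* (q :* k) :- (w :* q) :* (p :* e :* z :* k)) refl wᴺ w P Qᵏ Q e′ ⟩
      P * e′ * (Q * Qᵏ) - (w * Q) * (P * e′ * wᴺ * Qᵏ) ≈⟨ +-congˡ (-‿cong (*-identityˡ-≈1# wQ≈1 _)) ⟩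
      P * e′ * (Q * Qᵏ) - P * e′ * wᴺ * Qᵏ             ≈⟨ solve 5 (λ z p k q e → p :* e :* (q :* k) :- p :* e :* z :* k
                                                             := p :* (con (+ 1) :- z :* k) :* e :- p :* (con (+ 1) :- q :* k) :* e) refl wᴺ P Qᵏ Q e′ ⟩
      P * (1# - wᴺ * Qᵏ) * e′ - P * (1# - Q * Qᵏ) * e′ ≈⟨ +-cong (*-identityˡ-≈1# wQwᵏQᵏ≈1 _) (-‿cong (*-identityˡ-≈1# (wᵏQᵏ≈1 k) _)) ⟨
      ((w * Q) * (wᵏ * Qᵏ)) * (P * (1# - wᴺ * Qᵏ) * e′) - (wᵏ * Qᵏ) * (P * (1# - Q * Qᵏ) * e′)
        ≈⟨ solve 7 (λ w q wk k p z e′ → ((w :* q) :* (wk :* k)) :* (p :* (con (+ 1) :- z :* k) :* e′) :- (wk :* k) :* (p :* (con (+ 1) :- q :* k) :* e′)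
                                          := (wk :* w) :* ((p :* (con (+ 1) :- z :* k)) :* (k :* q) :* e′) :- wk :* (p :* k :* ((con (+ 1) :- q :* k) :* e′)))
                   refl w Q wᵏ Qᵏ P wᴺ e′ ⟩
      (wᵏ * w) * ((P * (1# - wᴺ * Qᵏ)) * (Qᵏ * Q) * e′) - wᵏ * (P * Qᵏ * ((1# - Q * Qᵏ) * e′))
        ≈⟨ +-congˡ (-‿cong (*-congˡ (*-congˡ (e-suc k sk<sl)))) ⟨
      (wᵏ * w) * ((P * (1# - wᴺ * Qᵏ)) * (Qᵏ * Q) * e′) - wᵏ * (P * Qᵏ * e k) ∎
      where
      wᴺ P Qᵏ wᵏ e′ : Carrier
      wᴺ = pow w N
      P = poch wᴺ Q k
      Qᵏ = pow Q k
      wᵏ = pow w k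
      e′ = e (suc k)
      wᴺwQ≈wᴺ : (wᴺ * w) * Q ≈ wᴺ
      wᴺwQ≈wᴺ = trans (*-assoc _ _ _) (trans (*-congˡ wQ≈1) (*-identityʳ _))
      wQwᵏQᵏ≈1 : (w * Q) * (wᵏ * Qᵏ) ≈ 1#
      wQwᵏQᵏ≈1 = trans (*-cong wQ≈1 (wᵏQᵏ≈1 k)) (*-identityˡ 1#)

    partialSum-suc : ∀ N m → m < suc l →
      partialSum (suc N) (suc m) ≈ x * partialSum N (suc m) + xPoch (suc m) * (pow w m * coefficient N m)
    partialSum-suc N zero _ =
      solve 2 (λ x e → con (+ 0) :+ con (+ 1) :* (con (+ 1) :* con (+ 1) :* e)
                       := x :* (con (+ 0) :+ con (+ 1) :* (con (+ 1) :* con (+ 1) :* e))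
                          :+ (con (+ 1) :* (con (+ 1) :- x :* con (+ 1))) :* (con (+ 1) :* (con (+ 1) :* con (+ 1) :* e))) refl x (e 0)
    partialSum-suc N (suc m) sm<sl = begin
      partialSum (suc N) (suc m) + X * coefficient (suc N) (suc m)
        ≈⟨ +-cong (partialSum-suc N m (ℕ.<-trans (ℕ.n<1+n m) sm<sl)) (*-congˡ (coefficient-contiguity N m sm<sl)) ⟩
      (x * S + X * (wᵐ * coefficient N m)) + X * (wᵐ⁺¹ * B - wᵐ * coefficient N m)
        ≈⟨ solve 6 (λ x s X u v c → (x :* s :+ X :* (u :* v)) :+ X :* (c :- u :* v) := x :* s :+ X :* c) refl x S X wᵐ (coefficient N m) (wᵐ⁺¹ * B) ⟩
      x * S + X * (wᵐ⁺¹ * B)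
        ≈⟨ solve 5 (λ x s X y B → x :* s :+ X :* y := x :* s :+ X :* y :+ (x :* X :* B) :* (con (+ 1) :- con (+ 1))) refl x S X (wᵐ⁺¹ * B) B ⟩
      x * S + X * (wᵐ⁺¹ * B) + (x * X * B) * (1# - 1#)
        ≈⟨ +-congˡ (*-congˡ (+-congˡ (-‿cong (wᵏQᵏ≈1 (suc m))))) ⟨
      x * S + X * (wᵐ⁺¹ * B) + (x * X * B) * (1# - wᵐ⁺¹ * pow Q (suc m))
        ≈⟨ solve 6 (λ x s X wk B q → x :* s :+ X :* (wk :* B) :+ (x :* X :* B) :* (con (+ 1) :- wk :* q)
                                     := x :* (s :+ X :* B) :+ (X :* (con (+ 1) :- x :* q)) :* (wk :* B)) refl x S X wᵐ⁺¹ B (pow Q (suc m)) ⟩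
      x * partialSum N (suc (suc m)) + xPoch (suc (suc m)) * (wᵐ⁺¹ * B) ∎
      where
      S X B wᵐ wᵐ⁺¹ : Carrier
      S = partialSum N (suc m)
      X = xPoch (suc m)
      B = coefficient N (suc m)
      wᵐ = pow w m
      wᵐ⁺¹ = pow w (suc m)

    partialSum-0 : ∀ m → m < suc l → partialSum 0 (suc m) ≈ 1#
    partialSum-0 zero 0<sl = begin
      0# + 1# * (1# * 1# * e 0)  ≈⟨ solve 1 (λ e → con (+ 0) :+ con (+ 1) :* (con (+ 1) :* con (+ 1) :* e) := e :* con (+ 1)) refl (e 0) ⟩
      e 0 * 1#                   ≈⟨ e-inverse 0 0<sl ⟩
      1#                         ∎
    partialSum-0 (suc m) sm<sl = begin
      partialSum 0 (suc m) + xPoch (suc m) * coefficient 0 (suc m)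
        ≈⟨ +-cong (partialSum-0 m (ℕ.<-trans (ℕ.n<1+n m) sm<sl)) (*-congˡ (coefficient-zero 0 (suc m) (s≤s z≤n))) ⟩
      1# + xPoch (suc m) * 0#  ≈⟨ trans (+-congˡ (zeroʳ _)) (+-identityʳ 1#) ⟩
      1#                       ∎

    partialSum-≤ : ∀ N m → m < suc l → N ≤ m → partialSum N (suc m) ≈ pow x N
    partialSum-≤ zero m m<sl _ = partialSum-0 m m<sl
    partialSum-≤ (suc N) m m<sl sN≤m = begin
      partialSum (suc N) (suc m)                                       ≈⟨ partialSum-suc N m m<sl ⟩
      x * partialSum N (suc m) + xPoch (suc m) * (pow w m * coefficient N m)
        ≈⟨ +-cong (*-congˡ (partialSum-≤ N m m<sl (ℕ.<⇒≤ sN≤m))) (*-congˡ (*-congˡ (coefficient-zero N m sN≤m))) ⟩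
      x * pow x N + xPoch (suc m) * (pow w m * 0#)
        ≈⟨ trans (+-congˡ (trans (*-congˡ (zeroʳ _)) (zeroʳ _))) (trans (+-identityʳ _) (*-comm _ _)) ⟩
      pow x N * x                                                      ∎

    chu-vandermonde : ∀ {N} → N < suc l → partialSum N (suc l) ≈ pow x N
    chu-vandermonde {N} N<sl = partialSum-≤ N l ℕ.≤-refl (ℕ.≤-pred N<sl)

    Qᴺ-inverse : ∀ {s} N → s * pow Q N ≈ 1# → s ≈ pow w N
    Qᴺ-inverse {s} N sQᴺ≈1 = begin
      s                              ≈⟨ *-identityʳ s ⟨
      s * 1#                         ≈⟨ *-congˡ (wᵏQᵏ≈1 N) ⟨
      s * (pow w N * pow Q N)        ≈⟨ solve 3 (λ s a b → s :* (a :* b) := (s :* b) :* a) refl s (pow w N) (pow Q N) ⟩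
      (s * pow Q N) * pow w N        ≈⟨ *-identityˡ-≈1# sQᴺ≈1 (pow w N) ⟩
      pow w N                        ∎

module Localisation (P : Poly) (n′ : ℕ)
  (P∣qⁿ-1 : Σ Poly λ R → QPowerMinusOne.qpowMinusOne (suc n′) Bivariate.≃ (P Defs.⊗ R)) where
  open import Data.Nat as ℕ using (zero; suc; _<_; _≤_; z≤n; s≤s)
  import Data.Nat.Properties as ℕ
  open import Data.Product using (_,_; proj₁; proj₂; _×_; swap)
  open import Data.Integer using (ℤ; +_)
  open import Data.Nat.Divisibility using (_∣_)
  open import Data.Empty using (⊥-elim)
  open import Relation.Nullary using (yes; no; ¬_)
  open import Relation.Binary.PropositionalEquality as ≡ using (_≡_)
  import Relation.Binary.Reasoning.Setoid as SetoidReasoning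
  open import Defs
  open Bivariate
  open QPowerMinusOne
  open AdmissibleDenominators

  n : ℕ
  n = suc n′

  open Modulo P n (s≤s z≤n) P∣qⁿ-1 public

  Local : Set
  Local = Σ Frac (λ F → Admissible (den F))

  numerator denominator : Local → Poly
  numerator F = num (proj₁ F)
  denominator F = den (proj₁ F)

  cross : Local → Local → Poly
  cross F G = (numerator F ⊗ denominator G) ⊕ (⊖ (numerator G ⊗ denominator F))

  -- Equality in the localisation of ℤ[x,q] at admissible elements, taken modulo P.
  infix 4 _≈ᴸ_
  record _≈ᴸ_ (F G : Local) : Set where
    constructor mk≈ᴸ
    field
      K : Poly
      K-admissible : Admissible K
      quotient : Poly
      divisible : (K ⊗ cross F G) ≃ (P ⊗ quotient)

  plusE timesE : ∀ {k} → Polynomial k × Polynomial k → Polynomial k × Polynomial k → Polynomial k × Polynomial k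
  plusE (a , b) (c , e) = ((a :* e) :+ (c :* b)) , (b :* e)
  timesE (a , b) (c , e) = (a :* c) , (b :* e)
  negE : ∀ {k} → Polynomial k × Polynomial k → Polynomial k × Polynomial k
  negE (a , b) = (:- a) , b
  crossE : ∀ {k} → Polynomial k × Polynomial k → Polynomial k × Polynomial k → Polynomial k
  crossE (a , b) (c , e) = (a :* e) :+ (:- (c :* b))
  zeroE oneE : ∀ {k} → Polynomial k × Polynomial k
  zeroE = con (+ 0) , con (+ 1)
  oneE = con (+ 1) , con (+ 1)

  cross≃0⇒≈ᴸ : ∀ F G → cross F G ≃ 0P → F ≈ᴸ G
  cross≃0⇒≈ᴸ F G h = mk≈ᴸ 1P Admissible-1P 0P (≃-trans (⊗-congˡ 1P h) (≃-trans (⊗-zeroʳ 1P) (≃-sym (⊗-zeroʳ P))))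

  _+̂_ _*̂_ _-̂_ : Local → Local → Local
  F +̂ G = (proj₁ F +F proj₁ G) , Admissible-⊗ (proj₂ F) (proj₂ G)
  F *̂ G = (proj₁ F *F proj₁ G) , Admissible-⊗ (proj₂ F) (proj₂ G)
  F -̂ G = (proj₁ F -F proj₁ G) , Admissible-⊗ (proj₂ F) (proj₂ G)
  -̂_ : Local → Local
  -̂ F = (⊖ numerator F , denominator F) , proj₂ F
  0̂ 1̂ : Local
  0̂ = 0F , Admissible-1P
  1̂ = 1F , Admissible-1P

  ≈ᴸ-refl : ∀ {F} → F ≈ᴸ F
  ≈ᴸ-refl {F} = cross≃0⇒≈ᴸ F F
    (solve 2 (λ a b → crossE (a , b) (a , b) := con (+ 0)) ≃-refl (numerator F) (denominator F))

  P-linear : ∀ x m y m′ → ((x ⊗ (P ⊗ m)) ⊕ (y ⊗ (P ⊗ m′))) ≃ (P ⊗ ((x ⊗ m) ⊕ (y ⊗ m′)))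
  P-linear = solve 5 (λ p x m y m′ → x :* (p :* m) :+ y :* (p :* m′) := p :* (x :* m :+ y :* m′)) ≃-refl P

  ≈ᴸ-sym : ∀ {F G} → F ≈ᴸ G → G ≈ᴸ F
  ≈ᴸ-sym {F} {G} (mk≈ᴸ K a m h) = mk≈ᴸ K a (⊖ m) (begin
      K ⊗ cross G F      ≈⟨ solve 5 (λ k a b c e → k :* crossE (c , e) (a , b) := :- (k :* crossE (a , b) (c , e)))
                                    ≃-refl K (numerator F) (denominator F) (numerator G) (denominator G) ⟩
      ⊖ (K ⊗ cross F G)  ≈⟨ ⊖-cong h ⟩
      ⊖ (P ⊗ m)          ≈⟨ solve 2 (λ p m → :- (p :* m) := p :* (:- m)) ≃-refl P m ⟩
      P ⊗ (⊖ m)          ∎)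
    where open SetoidReasoning ≃-setoid

  ≈ᴸ-trans : ∀ {F G H} → F ≈ᴸ G → G ≈ᴸ H → F ≈ᴸ H
  ≈ᴸ-trans {F} {G} {H} (mk≈ᴸ K₁ a₁ m₁ h₁) (mk≈ᴸ K₂ a₂ m₂ h₂) =
    mk≈ᴸ ((K₁ ⊗ K₂) ⊗ denominator G) (Admissible-⊗ (Admissible-⊗ a₁ a₂) (proj₂ G)) ((c₁ ⊗ m₁) ⊕ (c₂ ⊗ m₂)) (begin
      ((K₁ ⊗ K₂) ⊗ denominator G) ⊗ cross F H
        ≈⟨ solve 8 (λ k₁ k₂ a b c e f h →
             ((k₁ :* k₂) :* e) :* crossE (a , b) (f , h)
             := (k₂ :* h) :* (k₁ :* crossE (a , b) (c , e)) :+ (k₁ :* b) :* (k₂ :* crossE (c , e) (f , h)))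
           ≃-refl K₁ K₂ (numerator F) (denominator F) (numerator G) (denominator G) (numerator H) (denominator H) ⟩
      (c₁ ⊗ (K₁ ⊗ cross F G)) ⊕ (c₂ ⊗ (K₂ ⊗ cross G H))  ≈⟨ ⊕-cong (⊗-congˡ c₁ h₁) (⊗-congˡ c₂ h₂) ⟩
      (c₁ ⊗ (P ⊗ m₁)) ⊕ (c₂ ⊗ (P ⊗ m₂))                  ≈⟨ P-linear c₁ m₁ c₂ m₂ ⟩
      P ⊗ ((c₁ ⊗ m₁) ⊕ (c₂ ⊗ m₂))                        ∎)
    where
    open SetoidReasoning ≃-setoid
    c₁ c₂ : Poly
    c₁ = K₂ ⊗ denominator H
    c₂ = K₁ ⊗ denominator F

  +̂-cong : ∀ {F F′ G G′} → F ≈ᴸ F′ → G ≈ᴸ G′ → (F +̂ G) ≈ᴸ (F′ +̂ G′)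
  +̂-cong {F} {F′} {G} {G′} (mk≈ᴸ K₁ a₁ m₁ h₁) (mk≈ᴸ K₂ a₂ m₂ h₂) =
    mk≈ᴸ (K₁ ⊗ K₂) (Admissible-⊗ a₁ a₂) ((c₁ ⊗ m₁) ⊕ (c₂ ⊗ m₂)) (begin
      (K₁ ⊗ K₂) ⊗ cross (F +̂ G) (F′ +̂ G′)
        ≈⟨ solve 10 (λ k₁ k₂ a b a′ b′ c e c′ e′ →
             (k₁ :* k₂) :* crossE (plusE (a , b) (c , e)) (plusE (a′ , b′) (c′ , e′))
             := (k₂ :* (e :* e′)) :* (k₁ :* crossE (a , b) (a′ , b′)) :+ (k₁ :* (b :* b′)) :* (k₂ :* crossE (c , e) (c′ , e′)))
           ≃-refl K₁ K₂ (numerator F) (denominator F) (numerator F′) (denominator F′)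
                  (numerator G) (denominator G) (numerator G′) (denominator G′) ⟩
      (c₁ ⊗ (K₁ ⊗ cross F F′)) ⊕ (c₂ ⊗ (K₂ ⊗ cross G G′))  ≈⟨ ⊕-cong (⊗-congˡ c₁ h₁) (⊗-congˡ c₂ h₂) ⟩
      (c₁ ⊗ (P ⊗ m₁)) ⊕ (c₂ ⊗ (P ⊗ m₂))                    ≈⟨ P-linear c₁ m₁ c₂ m₂ ⟩
      P ⊗ ((c₁ ⊗ m₁) ⊕ (c₂ ⊗ m₂))                          ∎)
    where
    open SetoidReasoning ≃-setoid
    c₁ c₂ : Poly
    c₁ = K₂ ⊗ (denominator G ⊗ denominator G′)
    c₂ = K₁ ⊗ (denominator F ⊗ denominator F′)

  *̂-cong : ∀ {F F′ G G′} → F ≈ᴸ F′ → G ≈ᴸ G′ → (F *̂ G) ≈ᴸ (F′ *̂ G′)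
  *̂-cong {F} {F′} {G} {G′} (mk≈ᴸ K₁ a₁ m₁ h₁) (mk≈ᴸ K₂ a₂ m₂ h₂) =
    mk≈ᴸ (K₁ ⊗ K₂) (Admissible-⊗ a₁ a₂) ((c₁ ⊗ m₁) ⊕ (c₂ ⊗ m₂)) (begin
      (K₁ ⊗ K₂) ⊗ cross (F *̂ G) (F′ *̂ G′)
        ≈⟨ solve 10 (λ k₁ k₂ a b a′ b′ c e c′ e′ →
             (k₁ :* k₂) :* crossE (timesE (a , b) (c , e)) (timesE (a′ , b′) (c′ , e′))
             := (k₂ :* (c :* e′)) :* (k₁ :* crossE (a , b) (a′ , b′)) :+ (k₁ :* (a′ :* b)) :* (k₂ :* crossE (c , e) (c′ , e′)))
           ≃-refl K₁ K₂ (numerator F) (denominator F) (numerator F′) (denominator F′)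
                  (numerator G) (denominator G) (numerator G′) (denominator G′) ⟩
      (c₁ ⊗ (K₁ ⊗ cross F F′)) ⊕ (c₂ ⊗ (K₂ ⊗ cross G G′))  ≈⟨ ⊕-cong (⊗-congˡ c₁ h₁) (⊗-congˡ c₂ h₂) ⟩
      (c₁ ⊗ (P ⊗ m₁)) ⊕ (c₂ ⊗ (P ⊗ m₂))                    ≈⟨ P-linear c₁ m₁ c₂ m₂ ⟩
      P ⊗ ((c₁ ⊗ m₁) ⊕ (c₂ ⊗ m₂))                          ∎)
    where
    open SetoidReasoning ≃-setoid
    c₁ c₂ : Poly
    c₁ = K₂ ⊗ (numerator G ⊗ denominator G′)
    c₂ = K₁ ⊗ (numerator F′ ⊗ denominator F)

  -̂-cong : ∀ {F F′} → F ≈ᴸ F′ → (-̂ F) ≈ᴸ (-̂ F′)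
  -̂-cong {F} {F′} (mk≈ᴸ K a m h) = mk≈ᴸ K a (⊖ m) (begin
      K ⊗ cross (-̂ F) (-̂ F′)  ≈⟨ solve 5 (λ k a b a′ b′ → k :* crossE (negE (a , b)) (negE (a′ , b′)) := :- (k :* crossE (a , b) (a′ , b′)))
                                         ≃-refl K (numerator F) (denominator F) (numerator F′) (denominator F′) ⟩
      ⊖ (K ⊗ cross F F′)      ≈⟨ ⊖-cong h ⟩
      ⊖ (P ⊗ m)               ≈⟨ solve 2 (λ p m → :- (p :* m) := p :* (:- m)) ≃-refl P m ⟩
      P ⊗ (⊖ m)               ∎)
    where open SetoidReasoning ≃-setoid

  +̂-assoc : ∀ F G H → ((F +̂ G) +̂ H) ≈ᴸ (F +̂ (G +̂ H))
  +̂-assoc F G H = cross≃0⇒≈ᴸ ((F +̂ G) +̂ H) (F +̂ (G +̂ H)) (solve 6 (λ a b c e f h →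
    crossE (plusE (plusE (a , b) (c , e)) (f , h)) (plusE (a , b) (plusE (c , e) (f , h))) := con (+ 0))
      ≃-refl (numerator F) (denominator F) (numerator G) (denominator G) (numerator H) (denominator H))

  +̂-comm : ∀ F G → (F +̂ G) ≈ᴸ (G +̂ F)
  +̂-comm F G = cross≃0⇒≈ᴸ (F +̂ G) (G +̂ F) (solve 4 (λ a b c e →
    crossE (plusE (a , b) (c , e)) (plusE (c , e) (a , b)) := con (+ 0)) ≃-refl (numerator F) (denominator F) (numerator G) (denominator G))

  +̂-identityˡ : ∀ F → (0̂ +̂ F) ≈ᴸ F
  +̂-identityˡ F = cross≃0⇒≈ᴸ (0̂ +̂ F) F (solve 2 (λ a b → crossE (plusE zeroE (a , b)) (a , b) := con (+ 0))
      ≃-refl (numerator F) (denominator F))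

  +̂-identityʳ : ∀ F → (F +̂ 0̂) ≈ᴸ F
  +̂-identityʳ F = cross≃0⇒≈ᴸ (F +̂ 0̂) F (solve 2 (λ a b → crossE (plusE (a , b) zeroE) (a , b) := con (+ 0))
      ≃-refl (numerator F) (denominator F))

  -̂-inverseˡ : ∀ F → ((-̂ F) +̂ F) ≈ᴸ 0̂
  -̂-inverseˡ F = cross≃0⇒≈ᴸ ((-̂ F) +̂ F) 0̂ (solve 2 (λ a b → crossE (plusE (negE (a , b)) (a , b)) zeroE := con (+ 0))
      ≃-refl (numerator F) (denominator F))

  -̂-inverseʳ : ∀ F → (F +̂ (-̂ F)) ≈ᴸ 0̂
  -̂-inverseʳ F = cross≃0⇒≈ᴸ (F +̂ (-̂ F)) 0̂ (solve 2 (λ a b → crossE (plusE (a , b) (negE (a , b))) zeroE := con (+ 0))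
      ≃-refl (numerator F) (denominator F))

  *̂-assoc : ∀ F G H → ((F *̂ G) *̂ H) ≈ᴸ (F *̂ (G *̂ H))
  *̂-assoc F G H = cross≃0⇒≈ᴸ ((F *̂ G) *̂ H) (F *̂ (G *̂ H)) (solve 6 (λ a b c e f h →
    crossE (timesE (timesE (a , b) (c , e)) (f , h)) (timesE (a , b) (timesE (c , e) (f , h))) := con (+ 0))
      ≃-refl (numerator F) (denominator F) (numerator G) (denominator G) (numerator H) (denominator H))

  *̂-comm : ∀ F G → (F *̂ G) ≈ᴸ (G *̂ F)
  *̂-comm F G = cross≃0⇒≈ᴸ (F *̂ G) (G *̂ F) (solve 4 (λ a b c e →
    crossE (timesE (a , b) (c , e)) (timesE (c , e) (a , b)) := con (+ 0))
      ≃-refl (numerator F) (denominator F) (numerator G) (denominator G))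

  *̂-identityˡ : ∀ F → (1̂ *̂ F) ≈ᴸ F
  *̂-identityˡ F = cross≃0⇒≈ᴸ (1̂ *̂ F) F (solve 2 (λ a b → crossE (timesE oneE (a , b)) (a , b) := con (+ 0))
      ≃-refl (numerator F) (denominator F))

  *̂-identityʳ : ∀ F → (F *̂ 1̂) ≈ᴸ F
  *̂-identityʳ F = cross≃0⇒≈ᴸ (F *̂ 1̂) F (solve 2 (λ a b → crossE (timesE (a , b) oneE) (a , b) := con (+ 0))
      ≃-refl (numerator F) (denominator F))

  *̂-distribˡ : ∀ F G H → (F *̂ (G +̂ H)) ≈ᴸ ((F *̂ G) +̂ (F *̂ H))
  *̂-distribˡ F G H = cross≃0⇒≈ᴸ (F *̂ (G +̂ H)) ((F *̂ G) +̂ (F *̂ H)) (solve 6 (λ a b c e f h →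
    crossE (timesE (a , b) (plusE (c , e) (f , h))) (plusE (timesE (a , b) (c , e)) (timesE (a , b) (f , h))) := con (+ 0))
      ≃-refl (numerator F) (denominator F) (numerator G) (denominator G) (numerator H) (denominator H))

  *̂-distribʳ : ∀ F G H → ((G +̂ H) *̂ F) ≈ᴸ ((G *̂ F) +̂ (H *̂ F))
  *̂-distribʳ F G H = cross≃0⇒≈ᴸ ((G +̂ H) *̂ F) ((G *̂ F) +̂ (H *̂ F)) (solve 6 (λ a b c e f h →
    crossE (timesE (plusE (c , e) (f , h)) (a , b)) (plusE (timesE (c , e) (a , b)) (timesE (f , h) (a , b))) := con (+ 0))
      ≃-refl (numerator F) (denominator F) (numerator G) (denominator G) (numerator H) (denominator H))

  localRing : CommutativeRing 0ℓ 0ℓ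
  localRing = record
    { Carrier = Local ; _≈_ = _≈ᴸ_ ; _+_ = _+̂_ ; _*_ = _*̂_ ; -_ = -̂_ ; 0# = 0̂ ; 1# = 1̂
    ; isCommutativeRing = record
      { isRing = record
        { +-isAbelianGroup = record
          { isGroup = record
            { isMonoid = record
              { isSemigroup = record
                { isMagma = record { isEquivalence = record { refl = ≈ᴸ-refl ; sym = ≈ᴸ-sym ; trans = ≈ᴸ-trans } ; ∙-cong = +̂-cong }
                ; assoc = +̂-assoc }
              ; identity = +̂-identityˡ , +̂-identityʳ }
            ; inverse = -̂-inverseˡ , -̂-inverseʳ
            ; ⁻¹-cong = -̂-cong }
          ; comm = +̂-comm }
        ; *-cong = *̂-cong
        ; *-assoc = *̂-assoc
        ; *-identity = *̂-identityˡ , *̂-identityʳ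
        ; distrib = *̂-distribˡ , *̂-distribʳ }
      ; *-comm = *̂-comm }
    }

  -̂≈ᴸ+̂-̂ : ∀ F G → (F -̂ G) ≈ᴸ (F +̂ (-̂ G))
  -̂≈ᴸ+̂-̂ F G = cross≃0⇒≈ᴸ (F -̂ G) (F +̂ (-̂ G)) (solve 4 (λ a b c e →
     crossE ((a :* e) :+ :- (c :* b) , b :* e) (plusE (a , b) (negE (c , e))) := con (+ 0))
       ≃-refl (numerator F) (denominator F) (numerator G) (denominator G))

  module Chu = TerminatingChuVandermonde localRing
  open IntegerCoefficientSolver localRing using () renaming (solve to solveᴸ; _:*_ to _:*ᴸ_; _:=_ to _:=ᴸ_)

  ι : Poly → Local
  ι p = (p , 1P) , Admissible-1P

  ι-cong : ∀ {p r} → p ≃ r → ι p ≈ᴸ ι r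
  ι-cong {p} {r} h = cross≃0⇒≈ᴸ (ι p) (ι r) (≃-trans (⊕-cong (⊗-identityʳ p) (⊖-cong (⊗-identityʳ r)))
     (≃-trans (⊕-congʳ (⊖ r) h) (solve 1 (λ r → r :+ :- r := con (+ 0)) ≃-refl r)))

  ι-⊗ : ∀ p r → ι (p ⊗ r) ≈ᴸ (ι p *̂ ι r)
  ι-⊗ p r = cross≃0⇒≈ᴸ (ι (p ⊗ r)) (ι p *̂ ι r)
    (solve 2 (λ p r → crossE (p :* r , con (+ 1)) (timesE (p , con (+ 1)) (r , con (+ 1))) := con (+ 0)) ≃-refl p r)

  ι-qⁿ≈ᴸ1̂ : ι (qpow n) ≈ᴸ 1̂
  ι-qⁿ≈ᴸ1̂ = mk≈ᴸ 1P Admissible-1P R₀ (≃-trans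
    (solve 1 (λ a → con (+ 1) :* (a :* con (+ 1) :+ :- (con (+ 1) :* con (+ 1))) := a :+ :- con (+ 1)) ≃-refl (qpow n))
    (proj₂ P∣qⁿ-1))

  inverse : (G : Local) → Admissible (numerator G) → Local
  inverse G g = (denominator G , numerator G) , g

  inverse-*̂ : ∀ G g → (inverse G g *̂ G) ≈ᴸ 1̂
  inverse-*̂ G g = cross≃0⇒≈ᴸ (inverse G g *̂ G) 1̂ (solve 2 (λ a b → crossE (timesE (b , a) (a , b)) oneE := con (+ 0))
      ≃-refl (numerator G) (denominator G))

  pochᴸ : Local → Local → ℕ → Local
  pochᴸ a b zero = 1̂
  pochᴸ a b (suc k) = pochᴸ a b k *̂ (1̂ -̂ (a *̂ Chu.pow b k))

  pochᴸ≈ᴸpoch : ∀ a b k → pochᴸ a b k ≈ᴸ Chu.poch a b k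
  pochᴸ≈ᴸpoch a b zero = ≈ᴸ-refl
  pochᴸ≈ᴸpoch a b (suc k) = *̂-cong (pochᴸ≈ᴸpoch a b k) (-̂≈ᴸ+̂-̂ 1̂ (a *̂ Chu.pow b k))

  proj₁-pow : ∀ a k → proj₁ (Chu.pow a k) ≡ (proj₁ a ^F k)
  proj₁-pow a zero = ≡.refl
  proj₁-pow a (suc k) = ≡.cong (_*F proj₁ a) (proj₁-pow a k)

  proj₁-pochᴸ : ∀ a b k → proj₁ (pochᴸ a b k) ≡ poch (proj₁ a) (proj₁ b) k
  proj₁-pochᴸ a b zero = ≡.refl
  proj₁-pochᴸ a b (suc k) = ≡.cong₂ (λ u v → u *F (1F -F (proj₁ a *F v))) (proj₁-pochᴸ a b k) (proj₁-pow b k)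

  proj₁-sum : ∀ f g l → (∀ k → k < l → proj₁ (f k) ≡ g k) → proj₁ (Chu.sum f l) ≡ sumF g l
  proj₁-sum f g zero h = ≡.refl
  proj₁-sum f g (suc l) h = ≡.cong₂ _+F_ (proj₁-sum f g l (λ k k<l → h k (ℕ.m<n⇒m<1+n k<l))) (h l ℕ.≤-refl)

  q⁻¹ : Local
  q⁻¹ = (1P , qpow 1) , Admissible-qpow 1

  q·qᴹ≈ᴸ1̂ : ∀ M → suc M ≡ n → (ι (qpow 1) *̂ ι (qpow M)) ≈ᴸ 1̂
  q·qᴹ≈ᴸ1̂ M eq = ≈ᴸ-trans (≈ᴸ-sym (ι-⊗ (qpow 1) (qpow M)))
    (≈ᴸ-trans (ι-cong (≃-sym (qpow-+ 1 M))) (≡.subst (λ z → ι (qpow z) ≈ᴸ 1̂) (≡.sym eq) ι-qⁿ≈ᴸ1̂))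

  q⁻¹·qᴹ≈ᴸ1̂ : ∀ M → M ≡ suc n → (q⁻¹ *̂ ι (qpow M)) ≈ᴸ 1̂
  q⁻¹·qᴹ≈ᴸ1̂ M eq = ≈ᴸ-trans step ι-qⁿ≈ᴸ1̂
    where
    step : (q⁻¹ *̂ ι (qpow M)) ≈ᴸ ι (qpow n)
    step = cross≃0⇒≈ᴸ (q⁻¹ *̂ ι (qpow M)) (ι (qpow n)) (≃-trans
      (solve 3 (λ a b q → crossE (timesE (con (+ 1) , q) (a , con (+ 1))) (b , con (+ 1)) := a :+ :- (q :* b)) ≃-refl (qpow M) (qpow n) (qpow 1))
      (≃-trans (⊕-congʳ (⊖ (qpow 1 ⊗ qpow n)) (≃-reflexive (≡.cong qpow eq)))
        (≃-trans (⊕-congʳ (⊖ (qpow 1 ⊗ qpow n)) (qpow-+ 1 n)) (solve 1 (λ a → a :+ :- a := con (+ 0)) ≃-refl (qpow 1 ⊗ qpow n)))))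

  ≈ᴸ⇒CongMod : ∀ F G → F ≈ᴸ G → CongMod P (proj₁ F) (proj₁ G)
  ≈ᴸ⇒CongMod F G (mk≈ᴸ K a m eq) = K ⊗ cross F G , D ,
      ≃⇒≈ {cross F G ⊗ D} {(K ⊗ cross F G) ⊗ (denominator F ⊗ denominator G)}
        (solve 3 (λ c k d → c :* (k :* d) := (k :* c) :* d) ≃-refl (cross F G) K (denominator F ⊗ denominator G)) ,
      (m , ≃⇒≈ {K ⊗ cross F G} {P ⊗ m} eq) ,
      Admissible⇒Coprime D-admissible ,
      Admissible⇒≉0 D-admissible
    where
    D : Poly
    D = K ⊗ (denominator F ⊗ denominator G)
    D-admissible : Admissible D
    D-admissible = Admissible-⊗ a (Admissible-⊗ (proj₂ F) (proj₂ G))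

  summand : ℕ → ℤ → Poly → ℕ → Frac
  summand D s a k =
    ((poch (poly a) (qZ (+ D)) k *F poch (qZ s) (qZ (+ D)) k) /F poch (qZ (+ D)) (qZ (+ D)) k) *F qZ (+ (D ℕ.* k))

  module Base (D : ℕ) (D≥1 : 1 ≤ D)
              (Admissible-qpowMinusOne : ∀ {J} → 1 ≤ J → ¬ (n ∣ J) → Admissible (qpowMinusOne J))
              (n∤Dj : ∀ {j} → 1 ≤ j → j < n → ¬ (n ∣ D ℕ.* j)) where

    Q w : Local
    Q = ι (qpow D)
    w = (1P , qpow D) , Admissible-qpow D

    w*̂Q≈ᴸ1̂ : (w *̂ Q) ≈ᴸ 1̂
    w*̂Q≈ᴸ1̂ = cross≃0⇒≈ᴸ (w *̂ Q) 1̂ (solve 1 (λ q → crossE (timesE (con (+ 1) , q) (q , con (+ 1))) oneE := con (+ 0)) ≃-refl (qpow D))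

    qpow-D*suc : ∀ k → qpow (D ℕ.* suc k) ≃ (qpow (D ℕ.* k) ⊗ qpow D)
    qpow-D*suc k = ≃-trans (≃-reflexive (≡.cong qpow (≡.trans (ℕ.*-suc D k) (ℕ.+-comm D (D ℕ.* k))))) (qpow-+ (D ℕ.* k) D)

    numerator-Qᵏ : ∀ k → numerator (Chu.pow Q k) ≃ qpow (D ℕ.* k)
    numerator-Qᵏ zero = ≃-reflexive (≡.cong qpow (≡.sym (ℕ.*-zeroʳ D)))
    numerator-Qᵏ (suc k) = ≃-trans (⊗-congʳ (qpow D) (numerator-Qᵏ k)) (≃-sym (qpow-D*suc k))

    denominator-Qᵏ : ∀ k → denominator (Chu.pow Q k) ≃ 1P
    denominator-Qᵏ zero = ≃-refl
    denominator-Qᵏ (suc k) = ≃-trans (⊗-congʳ 1P (denominator-Qᵏ k)) (⊗-identityʳ 1P)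

    ι-qpow-D* : ∀ k → ι (qpow (D ℕ.* k)) ≈ᴸ Chu.pow Q k
    ι-qpow-D* k = cross≃0⇒≈ᴸ (ι (qpow (D ℕ.* k))) (Chu.pow Q k)
      (≃-trans (⊕-cong (⊗-congˡ (qpow (D ℕ.* k)) (denominator-Qᵏ k)) (⊖-cong (⊗-congʳ 1P (numerator-Qᵏ k))))
               (solve 1 (λ a → a :* con (+ 1) :+ :- (a :* con (+ 1)) := con (+ 0)) ≃-refl (qpow (D ℕ.* k))))

    numerator-1-QQᵏ : ∀ k → numerator (1̂ -̂ (Q *̂ Chu.pow Q k)) ≃ (⊖ qpowMinusOne (D ℕ.* suc k))
    numerator-1-QQᵏ k = begin
        (1P ⊗ (1P ⊗ denominator (Chu.pow Q k))) ⊕ (⊖ ((qpow D ⊗ numerator (Chu.pow Q k)) ⊗ 1P))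
          ≈⟨ ⊕-cong (⊗-congˡ 1P (⊗-congˡ 1P (denominator-Qᵏ k))) (⊖-cong (⊗-congʳ 1P (⊗-congˡ (qpow D) (numerator-Qᵏ k)))) ⟩
        (1P ⊗ (1P ⊗ 1P)) ⊕ (⊖ ((qpow D ⊗ qpow (D ℕ.* k)) ⊗ 1P))
          ≈⟨ solve 2 (λ a b → con (+ 1) :* (con (+ 1) :* con (+ 1)) :+ :- ((a :* b) :* con (+ 1)) := :- ((b :* a) :+ :- con (+ 1))) ≃-refl (qpow D) (qpow (D ℕ.* k)) ⟩
        ⊖ ((qpow (D ℕ.* k) ⊗ qpow D) ⊕ (⊖ 1P))
          ≈⟨ ⊖-cong (⊕-congʳ (⊖ 1P) (≃-sym (qpow-D*suc k))) ⟩
        ⊖ qpowMinusOne (D ℕ.* suc k) ∎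
      where open SetoidReasoning ≃-setoid

    Admissible-numerator-QQ : ∀ k → k < n → Admissible (numerator (pochᴸ Q Q k))
    Admissible-numerator-QQ zero _ = Admissible-1P
    Admissible-numerator-QQ (suc k) sk<n = Admissible-⊗ (Admissible-numerator-QQ k (ℕ.<-trans (ℕ.n<1+n k) sk<n))
      (Admissible-cong (≃-sym (numerator-1-QQᵏ k))
        (Admissible-⊖ (Admissible-qpowMinusOne (ℕ.*-mono-≤ D≥1 (s≤s z≤n)) (n∤Dj (s≤s z≤n) sk<n))))

    -- 1/(Q;Q)_k for k < n, and the junk value 0 beyond.
    inverse-QQ : ℕ → Local
    inverse-QQ k with k ℕ.<? n
    ... | yes k<n = inverse (pochᴸ Q Q k) (Admissible-numerator-QQ k k<n)
    ... | no _ = 0̂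

    inverse-QQ-*̂ : ∀ k → k < n → (inverse-QQ k *̂ Chu.poch Q Q k) ≈ᴸ 1̂
    inverse-QQ-*̂ k k<n with k ℕ.<? n
    ... | yes k<n′ = ≈ᴸ-trans (*̂-cong (≈ᴸ-refl {inverse (pochᴸ Q Q k) (Admissible-numerator-QQ k k<n′)}) (≈ᴸ-sym (pochᴸ≈ᴸpoch Q Q k)))
                              (inverse-*̂ (pochᴸ Q Q k) (Admissible-numerator-QQ k k<n′))
    ... | no k≮n = ⊥-elim (k≮n k<n)

    proj₁-inverse-QQ : ∀ k → k < n → proj₁ (inverse-QQ k) ≡ swap (poch (qZ (+ D)) (qZ (+ D)) k)
    proj₁-inverse-QQ k k<n with k ℕ.<? n
    ... | yes _ = ≡.cong swap (proj₁-pochᴸ Q Q k)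
    ... | no k≮n = ⊥-elim (k≮n k<n)

    sum≈ᴸpow : ∀ s (ŝ : Local) → proj₁ ŝ ≡ qZ s → ∀ {N} → N < n → (ŝ *̂ ι (qpow (D ℕ.* N))) ≈ᴸ 1̂ → ∀ a →
      Σ Local λ F → (proj₁ F ≡ sumF (summand D s a) n) × (F ≈ᴸ Chu.pow (ι a) N)
    sum≈ᴸpow s ŝ ŝ≡qˢ {N} N<n ŝqᴰᴺ≈1 a = Chu.sum term n , proj₁-sum term (summand D s a) n proj₁-term ,
      ≈ᴸ-trans (Chu.sum-cong n term≈ᴸ) (chu-vandermonde N<n)
      where
      open Chu.Sum Q w (ι a) w*̂Q≈ᴸ1̂ n′ inverse-QQ inverse-QQ-*̂
      term : ℕ → Local
      term k = ((pochᴸ (ι a) Q k *̂ pochᴸ ŝ Q k) *̂ inverse-QQ k) *̂ ι (qpow (D ℕ.* k))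
      ŝ≈ᴸwᴺ : ŝ ≈ᴸ Chu.pow w N
      ŝ≈ᴸwᴺ = Qᴺ-inverse N (≈ᴸ-trans (*̂-cong (≈ᴸ-refl {ŝ}) (≈ᴸ-sym (ι-qpow-D* N))) ŝqᴰᴺ≈1)
      term≈ᴸ : ∀ k → k < n → term k ≈ᴸ (xPoch k *̂ coefficient N k)
      term≈ᴸ k k<n = ≈ᴸ-trans
        (*̂-cong (*̂-cong (*̂-cong (pochᴸ≈ᴸpoch (ι a) Q k) (≈ᴸ-trans (pochᴸ≈ᴸpoch ŝ Q k) (Chu.poch-congˡ Q k ŝ≈ᴸwᴺ)))
                         (≈ᴸ-refl {inverse-QQ k}))
                (ι-qpow-D* k))
        (solveᴸ 4 (λ x p e q → ((x :*ᴸ p) :*ᴸ e) :*ᴸ q :=ᴸ x :*ᴸ ((p :*ᴸ q) :*ᴸ e)) ≈ᴸ-refl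
                (xPoch k) (Chu.poch (Chu.pow w N) Q k) (inverse-QQ k) (Chu.pow Q k))
      proj₁-term : ∀ k → k < n → proj₁ (term k) ≡ summand D s a k
      proj₁-term k k<n = ≡.cong₂ (λ u e → (u *F e) *F qZ (+ (D ℕ.* k)))
        (≡.cong₂ _*F_ (proj₁-pochᴸ (ι a) Q k) (≡.trans (proj₁-pochᴸ ŝ Q k) (≡.cong (λ z → poch z (qZ (+ D)) k) ŝ≡qˢ)))
        (proj₁-inverse-QQ k k<n)

module MainArgument (Φ : ℕ → Poly) (isCyclotomic : IsCyclotomic Φ) (n′ d : ℕ) (d≥2 : 2 ≤ d) where
  open import Data.Nat as ℕ using (zero; suc; _<_; _≤_; _*_; z≤n; s≤s)
  import Data.Nat.Properties as ℕ
  open import Data.Nat.Divisibility as ℕ using (divides)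
  open import Data.Integer using (+_; -[1+_]; _-_)
  import Data.Integer.Divisibility as ℤ
  open import Data.Product using (Σ; _×_; proj₁; proj₂)
  open import Data.Sum using (_⊎_; inj₁; inj₂)
  open import Relation.Binary.PropositionalEquality as ≡ using (_≡_)
  open import Relation.Nullary using (¬_)
  open import Defs
  open CyclotomicFactors Φ isCyclotomic using (module Order)
  open Order n′ using (Φ∣qⁿ-1; Admissible-qpowMinusOne)
  open Localisation (Φ (suc n′)) n′ Φ∣qⁿ-1

  d≥1 : 1 ≤ d
  d≥1 = ℕ.≤-trans (s≤s z≤n) d≥2

  -- D N ≡ ∓1 (mod n) makes D invertible modulo n.
  n∤Dj : ∀ {D N} → (suc (D * N) ≡ n ⊎ D * N ≡ suc n) → ∀ {j} → 1 ≤ j → j < n → ¬ (n ℕ.∣ D * j)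
  n∤Dj {D} {N} DN≡∓1 {j} j≥1 j<n n∣Dj = ℕ.<⇒≱ j<n (ℕ.∣⇒≤ ⦃ ℕ.>-nonZero j≥1 ⦄ (n∣j DN≡∓1))
    where
    n∣DNj : n ℕ.∣ (D * N) * j
    n∣DNj = ≡.subst (n ℕ.∣_) (≡.trans (≡.sym (ℕ.*-assoc N D j)) (≡.cong (_* j) (ℕ.*-comm N D))) (ℕ.∣-trans n∣Dj (ℕ.n∣m*n N))
    n∣j : (suc (D * N) ≡ n ⊎ D * N ≡ suc n) → n ℕ.∣ j
    n∣j (inj₁ e) = ℕ.∣m+n∣m⇒∣n (≡.subst (n ℕ.∣_) (≡.trans (≡.cong (_* j) (≡.sym e)) (ℕ.+-comm j _)) (ℕ.m∣m*n j)) n∣DNj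
    n∣j (inj₂ e) = ℕ.∣m+n∣m⇒∣n (≡.subst (n ℕ.∣_) (≡.trans (≡.cong (_* j) e) (ℕ.+-comm j _)) n∣DNj) (ℕ.m∣m*n j)

  congruence : ∀ s (ŝ : Local) → proj₁ ŝ ≡ qZ s → ∀ m → 2 * m < n → (ŝ *̂ ι (qpow (2 * d * m))) ≈ᴸ 1̂ →
    (∀ {j} → 1 ≤ j → j < n → ¬ (n ℕ.∣ 2 * d * j)) → CongMod (Φ n) (LHS d s n) (RHS d s n)
  congruence s ŝ ŝ≡qˢ m 2m<n ŝq²ᵈᵐ≈1 n∤2dj =
    ≡.subst₂ (CongMod (Φ n)) (proj₁ (proj₂ left)) (proj₁ (proj₂ right))
      (≈ᴸ⇒CongMod _ _ (≈ᴸ-trans (proj₂ (proj₂ left)) (≈ᴸ-sym (≈ᴸ-trans (proj₂ (proj₂ right)) [x²]ᵐ≈x²ᵐ))))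
    where
    d*2m≡2d*m : d * (2 * m) ≡ 2 * d * m
    d*2m≡2d*m = ≡.trans (≡.sym (ℕ.*-assoc d 2 m)) (≡.cong (_* m) (ℕ.*-comm d 2))
    n∣dj⇒n∣2dj : ∀ {j} → n ℕ.∣ d * j → n ℕ.∣ 2 * d * j
    n∣dj⇒n∣2dj {j} n∣dj = ≡.subst (n ℕ.∣_) (≡.sym (ℕ.*-assoc 2 d j)) (ℕ.∣-trans n∣dj (ℕ.n∣m*n 2))
    left : Σ Local λ F → (proj₁ F ≡ sumF (summand d s xP) n) × (F ≈ᴸ Chu.pow (ι xP) (2 * m))
    left = Base.sum≈ᴸpow d d≥1 Admissible-qpowMinusOne (λ j≥1 j<n n∣dj → n∤2dj j≥1 j<n (n∣dj⇒n∣2dj n∣dj)) s ŝ ŝ≡qˢ 2m<n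
             (≡.subst (λ k → (ŝ *̂ ι (qpow k)) ≈ᴸ 1̂) (≡.sym d*2m≡2d*m) ŝq²ᵈᵐ≈1) xP
    right : Σ Local λ F → (proj₁ F ≡ sumF (summand (2 * d) s (xP ⊗ xP)) n) × (F ≈ᴸ Chu.pow (ι (xP ⊗ xP)) m)
    right = Base.sum≈ᴸpow (2 * d) (ℕ.≤-trans d≥1 (ℕ.m≤m+n d _)) Admissible-qpowMinusOne n∤2dj s ŝ ŝ≡qˢ
              (ℕ.≤-<-trans (ℕ.m≤n*m m 2) 2m<n) ŝq²ᵈᵐ≈1 (xP ⊗ xP)
    [x²]ᵐ≈x²ᵐ : Chu.pow (ι (xP ⊗ xP)) m ≈ᴸ Chu.pow (ι xP) (2 * m)
    [x²]ᵐ≈x²ᵐ = ≈ᴸ-trans (Chu.pow-cong m (≈ᴸ-trans (ι-⊗ xP xP) (≈ᴸ-sym (*̂-cong (*̂-identityˡ (ι xP)) (≈ᴸ-refl {ι xP})))))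
                       (Chu.pow-pow (ι xP) 2 m)

  2m<n : ∀ {m} → (suc (2 * d * m) ≡ n ⊎ 2 * d * m ≡ suc n) → 2 * m < n
  2m<n {m} (inj₁ e) = ≡.subst (2 * m <_) e (s≤s (ℕ.*-monoˡ-≤ m (ℕ.*-monoʳ-≤ 2 d≥1)))
  2m<n {zero} (inj₂ e) = s≤s z≤n
  2m<n {suc m} (inj₂ e) = s≤s (ℕ.+-cancelʳ-≤ 2 (2 * suc m) n′ (begin
      2 * suc m ℕ.+ 2           ≤⟨ ℕ.+-monoʳ-≤ (2 * suc m) (ℕ.*-monoʳ-≤ 2 (s≤s z≤n)) ⟩
      2 * suc m ℕ.+ 2 * suc m   ≡⟨ ℕ.*-distribʳ-+ (suc m) 2 2 ⟨
      4 * suc m                 ≤⟨ ℕ.*-monoˡ-≤ (suc m) (ℕ.*-monoʳ-≤ 2 d≥2) ⟩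
      2 * d * suc m             ≡⟨ ≡.trans e (ℕ.+-comm 2 n′) ⟩
      n′ ℕ.+ 2                  ∎))
    where open ℕ.≤-Reasoning

  LHS≡RHS-mod-Φ : ∀ s → (s ≡ -[1+ 0 ] ⊎ s ≡ + 1) → + (2 * d) ℤ.∣ (+ n - s) → CongMod (Φ n) (LHS d s n) (RHS d s n)
  LHS≡RHS-mod-Φ .(+ 1) (inj₂ ≡.refl) (divides m n′≡m*2d) =
    congruence (+ 1) (ι (qpow 1)) ≡.refl m (2m<n (inj₁ e)) (q·qᴹ≈ᴸ1̂ (2 * d * m) e) (n∤Dj {2 * d} {m} (inj₁ e))
    where
    e : suc (2 * d * m) ≡ n
    e = ≡.cong suc (≡.trans (ℕ.*-comm (2 * d) m) (≡.sym n′≡m*2d))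
  LHS≡RHS-mod-Φ .(-[1+ 0 ]) (inj₁ ≡.refl) (divides m n+1≡m*2d) =
    congruence -[1+ 0 ] q⁻¹ ≡.refl m (2m<n (inj₂ e)) (q⁻¹·qᴹ≈ᴸ1̂ (2 * d * m) e) (n∤Dj {2 * d} {m} (inj₂ e))
    where
    e : 2 * d * m ≡ suc n
    e = ≡.trans (ℕ.*-comm (2 * d) m) (≡.trans (≡.sym n+1≡m*2d) (ℕ.+-comm n 1))

open import Defs
open import Data.Nat using (ℕ; _≤_; _*_)
open import Data.Integer using (ℤ; +_; -[1+_]; _-_)
open import Data.Integer.Divisibility using (_∣_)
open import Data.Sum using (_⊎_)
open import Relation.Binary.PropositionalEquality using (_≡_)

theorem1p3 : (Φ : ℕ → Poly) → IsCyclotomic Φ →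
    (d n : ℕ) → 2 ≤ d → 1 ≤ n →
    (s : ℤ) → (s ≡ -[1+ 0 ] ⊎ s ≡ + 1) → (+ (2 * d)) ∣ (+ n - s) →
    CongMod (Φ n) (LHS d s n) (RHS d s n)
theorem1p3 Φ isCyclotomic d (suc n′) d≥2 _ = MainArgument.LHS≡RHS-mod-Φ Φ isCyclotomic n′ d d≥2
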